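{- Let $A$ be a proposition in the language of $\mathrm{HA}_N$. If $A$ is provable in $\mathrm{HA}_{Class}$, then $A$ is provable in $\mathrm{HA}_N$.
   Context: All theories are in intuitionistic (many-sorted) predicate logic. $\mathrm{HA}_N$ is the one-sorted theory over the language $0, S, +, \times, =, Pred, Null, N$ ($Null$, $N$ unary predicates) whose axioms are: the axioms of equality for all these symbols; the relativized induction scheme $(0/x)P \Rightarrow \forall y~(N(y) \Rightarrow (y/x)P \Rightarrow (S(y)/x)P) \Rightarrow \forall n~(N(n) \Rightarrow (n/x)P)$ for every proposition $P$ of this language; $N(0)$, $\forall x~(N(x)\Rightarrow N(S(x)))$, $Pred(0)=0$, $\forall x~(Pred(S(x))=x)$, $Null(0)$, $\forall x~\neg Null(S(x))$, $\forall y~(0+y=y)$, $\forall x\forall y~(S(x)+y=S(x+y))$, $\forall y~(0\times y=0)$, $\forall x\forall y~(S(x)\times y=x\times y+y)$. $\mathrm{HA}_{Class}$ is the two-sorted theory with sorts $\iota$ (numbers) and $\kappa$ (classes). Its language has constant $0:\iota$, function symbols $S, Pred$ of rank $\iota\to\iota$, $+,\times$ of rank $\iota,\iota\to\iota$, predicate symbols $=$ on $\iota,\iota$, $Null$ and $N$ on $\iota$, $\in$ on $\iota,\kappa$, and, for each proposition $P$ of the language $0,S,Pred,+,\times,=,Null,N$ whose free variables are among the $\iota$-variables $x,y_1,\dots,y_n$, a function symbol $f_{x,y_1,\dots,y_n,P}$ of rank $\iota,\dots,\iota\to\kappa$ ($n$ arguments). Its axioms (there are no separate equality axioms) are: $\forall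 y\forall z~(y=z\Leftrightarrow\forall p~(y\in p\Rightarrow z\in p))$; $\forall n~(N(n)\Leftrightarrow\forall p~(0\in p\Rightarrow\forall y~(N(y)\Rightarrow y\in p\Rightarrow S(y)\in p)\Rightarrow n\in p))$; for each such $P$, $\forall x\forall y_1\dots\forall y_n~(x\in f_{x,y_1,\dots,y_n,P}(y_1,\dots,y_n)\Leftrightarrow P)$; $Pred(0)=0$, $\forall x~(Pred(S(x))=x)$, $Null(0)$, $\forall x~\neg Null(S(x))$, $\forall y~(0+y=y)$, $\forall x\forall y~(S(x)+y=S(x+y))$, $\forall y~(0\times y=0)$, $\forall x\forall y~(S(x)\times y=x\times y+y)$. Here $p$ ranges over sort $\kappa$ and the other variables over sort $\iota$. -}

module Defs where

open import Data.Unit using (⊤; tt)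
open import Data.List using (List; []; _∷_; map)
open import Data.List.Membership.Propositional using (_∈_)
open import Function using (const)

-- Generic many-sorted first-order syntax (no built-in equality),
-- intrinsically scoped de Bruijn variables.

record Sig : Set₁ where
  field
    Sort : Set
    Fun  : List Sort → Sort → Set
    Rel  : List Sort → Set

module Syntax (Σ : Sig) where
  open Sig Σ public

  Ctx : Set
  Ctx = List Sort

  data Var : Ctx → Sort → Set where
    here  : ∀ {Γ s} → Var (s ∷ Γ) s
    there : ∀ {Γ s t} → Var Γ s → Var (t ∷ Γ) s

  mutual
    data Term (Γ : Ctx) : Sort → Set where
      var : ∀ {s} → Var Γ s → Term Γ s
      app : ∀ {ss s} → Fun ss s → Terms Γ ss → Term Γ s

    data Terms (Γ : Ctx) : List Sort → Set where
      []  : Terms Γ []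
      _∷_ : ∀ {s ss} → Term Γ s → Terms Γ ss → Terms Γ (s ∷ ss)

  infixr 6 _∧'_
  infixr 5 _∨'_
  infixr 4 _⇒'_ _⇔'_

  data Form (Γ : Ctx) : Set where
    rel  : ∀ {ss} → Rel ss → Terms Γ ss → Form Γ
    ⊤' ⊥' : Form Γ
    _∧'_ _∨'_ _⇒'_ : Form Γ → Form Γ → Form Γ
    ∀' ∃' : (s : Sort) → Form (s ∷ Γ) → Form Γ

  ¬'_ : ∀ {Γ} → Form Γ → Form Γ
  ¬' A = A ⇒' ⊥'

  _⇔'_ : ∀ {Γ} → Form Γ → Form Γ → Form Γ
  A ⇔' B = (A ⇒' B) ∧' (B ⇒' A)

  -- universal closure: close (s₁ ∷ … ∷ sₖ) A = ∀ sₖ … ∀ s₁ A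
  close : ∀ Γ → Form Γ → Form []
  close []      A = A
  close (s ∷ Γ) A = close Γ (∀' s A)

  Ren : Ctx → Ctx → Set
  Ren Γ Δ = ∀ {s} → Var Γ s → Var Δ s

  liftR : ∀ {Γ Δ t} → Ren Γ Δ → Ren (t ∷ Γ) (t ∷ Δ)
  liftR ρ here      = here
  liftR ρ (there v) = there (ρ v)

  mutual
    renT : ∀ {Γ Δ s} → Ren Γ Δ → Term Γ s → Term Δ s
    renT ρ (var v)    = var (ρ v)
    renT ρ (app f ts) = app f (renTs ρ ts)

    renTs : ∀ {Γ Δ ss} → Ren Γ Δ → Terms Γ ss → Terms Δ ss
    renTs ρ []       = []
    renTs ρ (t ∷ ts) = renT ρ t ∷ renTs ρ ts

  renF : ∀ {Γ Δ} → Ren Γ Δ → Form Γ → Form Δ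
  renF ρ (rel r ts) = rel r (renTs ρ ts)
  renF ρ ⊤'         = ⊤'
  renF ρ ⊥'         = ⊥'
  renF ρ (A ∧' B)   = renF ρ A ∧' renF ρ B
  renF ρ (A ∨' B)   = renF ρ A ∨' renF ρ B
  renF ρ (A ⇒' B)   = renF ρ A ⇒' renF ρ B
  renF ρ (∀' s A)   = ∀' s (renF (liftR ρ) A)
  renF ρ (∃' s A)   = ∃' s (renF (liftR ρ) A)

  wkF : ∀ {Γ t} → Form Γ → Form (t ∷ Γ)
  wkF = renF there

  fromEmpty : ∀ {Γ} → Ren [] Γ
  fromEmpty ()

  Sub : Ctx → Ctx → Set
  Sub Γ Δ = ∀ {s} → Var Γ s → Term Δ s

  liftS : ∀ {Γ Δ t} → Sub Γ Δ → Sub (t ∷ Γ) (t ∷ Δ)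
  liftS σ here      = var here
  liftS σ (there v) = renT there (σ v)

  mutual
    subT : ∀ {Γ Δ s} → Sub Γ Δ → Term Γ s → Term Δ s
    subT σ (var v)    = σ v
    subT σ (app f ts) = app f (subTs σ ts)

    subTs : ∀ {Γ Δ ss} → Sub Γ Δ → Terms Γ ss → Terms Δ ss
    subTs σ []       = []
    subTs σ (t ∷ ts) = subT σ t ∷ subTs σ ts

  subF : ∀ {Γ Δ} → Sub Γ Δ → Form Γ → Form Δ
  subF σ (rel r ts) = rel r (subTs σ ts)
  subF σ ⊤'         = ⊤'
  subF σ ⊥'         = ⊥'
  subF σ (A ∧' B)   = subF σ A ∧' subF σ B
  subF σ (A ∨' B)   = subF σ A ∨' subF σ B
  subF σ (A ⇒' B)   = subF σ A ⇒' subF σ B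
  subF σ (∀' s A)   = ∀' s (subF (liftS σ) A)
  subF σ (∃' s A)   = ∃' s (subF (liftS σ) A)

  σ₀ : ∀ {Γ s} → Term Γ s → Sub (s ∷ Γ) Γ
  σ₀ t here      = t
  σ₀ t (there v) = var v

  _[_] : ∀ {Γ s} → Form (s ∷ Γ) → Term Γ s → Form Γ
  A [ t ] = subF (σ₀ t) A

  σ₀' : ∀ {Γ s} → Term (s ∷ Γ) s → Sub (s ∷ Γ) (s ∷ Γ)
  σ₀' t here      = t
  σ₀' t (there v) = var (there v)

  varsOf : ∀ Γ → Terms Γ Γ
  varsOf []      = []
  varsOf (s ∷ Γ) = var here ∷ renTs there (varsOf Γ)

  replaceAt : ∀ {Γ ss s} → Var ss s → Terms Γ ss → Term Γ s → Terms Γ ss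
  replaceAt here      (_ ∷ ts) u = u ∷ ts
  replaceAt (there i) (t ∷ ts) u = t ∷ replaceAt i ts u

  lookupT : ∀ {Γ ss s} → Var ss s → Terms Γ ss → Term Γ s
  lookupT here      (t ∷ _)  = t
  lookupT (there i) (_ ∷ ts) = lookupT i ts

  -- Intuitionistic natural deduction, relative to a set of closed axioms.
  -- Judgement  Γ ⊩ Hs ⊢ A : in variable context Γ, from hypotheses Hs, A.

  module Deduction (Ax : Form [] → Set) where

    infix 3 _⊩_⊢_

    data _⊩_⊢_ : (Γ : Ctx) → List (Form Γ) → Form Γ → Set where
      hyp  : ∀ {Γ Hs A} → A ∈ Hs → Γ ⊩ Hs ⊢ A
      ax   : ∀ {Γ Hs A} → Ax A → Γ ⊩ Hs ⊢ renF fromEmpty A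
      ⊤I   : ∀ {Γ Hs} → Γ ⊩ Hs ⊢ ⊤'
      ⊥E   : ∀ {Γ Hs A} → Γ ⊩ Hs ⊢ ⊥' → Γ ⊩ Hs ⊢ A
      ∧I   : ∀ {Γ Hs A B} → Γ ⊩ Hs ⊢ A → Γ ⊩ Hs ⊢ B → Γ ⊩ Hs ⊢ A ∧' B
      ∧E₁  : ∀ {Γ Hs A B} → Γ ⊩ Hs ⊢ A ∧' B → Γ ⊩ Hs ⊢ A
      ∧E₂  : ∀ {Γ Hs A B} → Γ ⊩ Hs ⊢ A ∧' B → Γ ⊩ Hs ⊢ B
      ∨I₁  : ∀ {Γ Hs A B} → Γ ⊩ Hs ⊢ A → Γ ⊩ Hs ⊢ A ∨' B
      ∨I₂  : ∀ {Γ Hs A B} → Γ ⊩ Hs ⊢ B → Γ ⊩ Hs ⊢ A ∨' B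
      ∨E   : ∀ {Γ Hs A B C} → Γ ⊩ Hs ⊢ A ∨' B →
             Γ ⊩ A ∷ Hs ⊢ C → Γ ⊩ B ∷ Hs ⊢ C → Γ ⊩ Hs ⊢ C
      ⇒I   : ∀ {Γ Hs A B} → Γ ⊩ A ∷ Hs ⊢ B → Γ ⊩ Hs ⊢ A ⇒' B
      ⇒E   : ∀ {Γ Hs A B} → Γ ⊩ Hs ⊢ A ⇒' B → Γ ⊩ Hs ⊢ A → Γ ⊩ Hs ⊢ B
      ∀I   : ∀ {Γ Hs s A} → (s ∷ Γ) ⊩ map wkF Hs ⊢ A → Γ ⊩ Hs ⊢ ∀' s A
      ∀E   : ∀ {Γ Hs s A} → Γ ⊩ Hs ⊢ ∀' s A → (t : Term Γ s) → Γ ⊩ Hs ⊢ A [ t ]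
      ∃I   : ∀ {Γ Hs s A} → (t : Term Γ s) → Γ ⊩ Hs ⊢ A [ t ] → Γ ⊩ Hs ⊢ ∃' s A
      ∃E   : ∀ {Γ Hs s A C} → Γ ⊩ Hs ⊢ ∃' s A →
             (s ∷ Γ) ⊩ A ∷ map wkF Hs ⊢ wkF C → Γ ⊩ Hs ⊢ C

    Provable : ∀ {Γ} → Form Γ → Set
    Provable {Γ} A = Γ ⊩ [] ⊢ A

data FunN : List ⊤ → ⊤ → Set where
  zeroF        : FunN [] tt
  sucF predF   : FunN (tt ∷ []) tt
  plusF timesF : FunN (tt ∷ tt ∷ []) tt

data RelN : List ⊤ → Set where
  eqR        : RelN (tt ∷ tt ∷ [])
  nullR natR : RelN (tt ∷ [])

sigN : Sig
sigN = record { Sort = ⊤ ; Fun = FunN ; Rel = RelN }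

module LN = Syntax sigN

data SortC : Set where
  ι κ : SortC

ιs : List ⊤ → List SortC
ιs = map (const ι)

data FunC : List SortC → SortC → Set where
  baseF : ∀ {ss} → FunN ss tt → FunC (ιs ss) ι
  -- f_{x,y₁,…,yₙ,P}: P has free variables among x (de Bruijn 0) and
  -- y₁,…,yₙ (the context ys, y₁ = de Bruijn 1, …); arguments y₁ … yₙ.
  compF : (ys : List ⊤) → LN.Form (tt ∷ ys) → FunC (ιs ys) κ

data RelC : List SortC → Set where
  baseR : ∀ {ss} → RelN ss → RelC (ιs ss)
  memR  : RelC (ι ∷ κ ∷ [])

sigC : Sig
sigC = record { Sort = SortC ; Fun = FunC ; Rel = RelC }

module LC = Syntax sigC

embV : ∀ {Γ} → LN.Var Γ tt → LC.Var (ιs Γ) ι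
embV LN.here      = LC.here
embV (LN.there v) = LC.there (embV v)

mutual
  embT : ∀ {Γ} → LN.Term Γ tt → LC.Term (ιs Γ) ι
  embT (LN.var v)    = LC.var (embV v)
  embT (LN.app f ts) = LC.app (baseF f) (embTs ts)

  embTs : ∀ {Γ ss} → LN.Terms Γ ss → LC.Terms (ιs Γ) (ιs ss)
  embTs LN.[]       = LC.[]
  embTs (t LN.∷ ts) = embT t LC.∷ embTs ts

embF : ∀ {Γ} → LN.Form Γ → LC.Form (ιs Γ)
embF (LN.rel r ts) = LC.rel (baseR r) (embTs ts)
embF LN.⊤'         = LC.⊤'
embF LN.⊥'         = LC.⊥'
embF (A LN.∧' B)   = embF A LC.∧' embF B
embF (A LN.∨' B)   = embF A LC.∨' embF B
embF (A LN.⇒' B)   = embF A LC.⇒' embF B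
embF (LN.∀' s A)   = LC.∀' ι (embF A)
embF (LN.∃' s A)   = LC.∃' ι (embF A)

module NNot where
  open LN
  infixl 8 _`+_
  infixl 9 _`×_
  infix 7 _`=_
  x0 : ∀ {Γ} → Term (tt ∷ Γ) tt
  x0 = var here
  x1 : ∀ {Γ} → Term (tt ∷ tt ∷ Γ) tt
  x1 = var (there here)

  `0 : ∀ {Γ} → Term Γ tt
  `0 = app zeroF []
  `S `P : ∀ {Γ} → Term Γ tt → Term Γ tt
  `S t = app sucF (t ∷ [])
  `P t = app predF (t ∷ [])
  _`+_ _`×_ : ∀ {Γ} → Term Γ tt → Term Γ tt → Term Γ tt
  t `+ u = app plusF (t ∷ u ∷ [])
  t `× u = app timesF (t ∷ u ∷ [])
  _`=_ : ∀ {Γ} → Term Γ tt → Term Γ tt → Form Γ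
  t `= u = rel eqR (t ∷ u ∷ [])
  `Null `N : ∀ {Γ} → Term Γ tt → Form Γ
  `Null t = rel nullR (t ∷ [])
  `N t = rel natR (t ∷ [])
  ∀x ∃x : ∀ {Γ} → Form (tt ∷ Γ) → Form Γ
  ∀x = ∀' tt
  ∃x = ∃' tt

open NNot

-- The arithmetic axioms common to HA_N and HA_Class
-- (in ∀x∀y A, x is de Bruijn 1 and y is de Bruijn 0)
data ArithAx : LN.Form [] → Set where
  pred0  : ArithAx (`P `0 `= `0)
  predS  : ArithAx (∀x (`P (`S x0) `= x0))
  null0  : ArithAx (`Null `0)
  nullS  : ArithAx (∀x (LN.¬' `Null (`S x0)))
  plus0  : ArithAx (∀x (`0 `+ x0 `= x0))
  plusS  : ArithAx (∀x (∀x (`S x1 `+ x0 `= `S (x1 `+ x0))))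
  times0 : ArithAx (∀x (`0 `× x0 `= `0))
  timesS : ArithAx (∀x (∀x (`S x1 `× x0 `= (x1 `× x0) `+ x0)))

-- Axioms of equality: reflexivity, and for every function / predicate
-- symbol and every argument position i:
--   ∀ w₁…wₖ ∀y (wᵢ = y ⇒ f(w⃗) = f(w⃗[i:=y]))
--   ∀ w₁…wₖ ∀y (wᵢ = y ⇒ R(w⃗) ⇒ R(w⃗[i:=y]))
data EqAx : LN.Form [] → Set where
  eqRefl : EqAx (∀x (x0 `= x0))
  eqFun  : ∀ {ss} (f : FunN ss tt) (i : LN.Var ss tt) →
    let w = LN.renTs LN.there (LN.varsOf ss) in
    EqAx (LN.close ss (∀x ((LN.lookupT i w `= x0) LN.⇒'
           (LN.app f w `= LN.app f (LN.replaceAt i w x0)))))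
  eqRel  : ∀ {ss} (r : RelN ss) (i : LN.Var ss tt) →
    let w = LN.renTs LN.there (LN.varsOf ss) in
    EqAx (LN.close ss (∀x ((LN.lookupT i w `= x0) LN.⇒'
           (LN.rel r w LN.⇒' LN.rel r (LN.replaceAt i w x0)))))

-- Induction scheme: for P with x = de Bruijn 0 and parameters Γ
-- (universally closed):
--  (0/x)P ⇒ ∀y (N(y) ⇒ (y/x)P ⇒ (S(y)/x)P) ⇒ ∀n (N(n) ⇒ (n/x)P)
inductionInstance : ∀ Γ → LN.Form (tt ∷ Γ) → LN.Form []
inductionInstance Γ P = LN.close Γ
  ( (P LN.[ `0 ])
    LN.⇒' ∀x (`N x0 LN.⇒' P LN.⇒' LN.subF (LN.σ₀' (`S x0)) P)
    LN.⇒' ∀x (`N x0 LN.⇒' P) )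

data HA-N-Ax : LN.Form [] → Set where
  equality  : ∀ {A} → EqAx A → HA-N-Ax A
  induction : ∀ Γ (P : LN.Form (tt ∷ Γ)) → HA-N-Ax (inductionInstance Γ P)
  nat0      : HA-N-Ax (`N `0)
  natS      : HA-N-Ax (∀x (`N x0 LN.⇒' `N (`S x0)))
  arith     : ∀ {A} → ArithAx A → HA-N-Ax A

module HA-N = LN.Deduction HA-N-Ax

module CNot where
  open LC
  infix 7 _∈'_ _c=_
  cι : ∀ {Γ} → Term (ι ∷ Γ) ι
  cι = var here
  _∈'_ : ∀ {Γ} → Term Γ ι → Term Γ κ → Form Γ
  t ∈' p = rel memR (t ∷ p ∷ [])
  c0 : ∀ {Γ} → Term Γ ι
  c0 = app (baseF zeroF) []
  cS : ∀ {Γ} → Term Γ ι → Term Γ ι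
  cS t = app (baseF sucF) (t ∷ [])
  _c=_ : ∀ {Γ} → Term Γ ι → Term Γ ι → Form Γ
  t c= u = rel (baseR eqR) (t ∷ u ∷ [])
  cN : ∀ {Γ} → Term Γ ι → Form Γ
  cN t = rel (baseR natR) (t ∷ [])

open CNot

-- comprehension: ∀x∀y₁…∀yₙ (x ∈ f_{x,y⃗,P}(y⃗) ⇔ P)
-- (closure written with de Bruijn order; only the order of the
--  leading universal quantifiers differs)
comprehension : ∀ ys → LN.Form (tt ∷ ys) → LC.Form []
comprehension ys P = LC.close (ι ∷ ιs ys)
  ( (LC.var LC.here ∈'
       LC.app (compF ys P) (LC.renTs LC.there (LC.varsOf (ιs ys))))
    LC.⇔' embF P )

data HA-Class-Ax : LC.Form [] → Set where
  -- ∀y∀z (y = z ⇔ ∀p (y ∈ p ⇒ z ∈ p))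
  leibniz : HA-Class-Ax
    (LC.∀' ι (LC.∀' ι
      ((LC.var (LC.there LC.here) c= LC.var LC.here) LC.⇔'
        LC.∀' κ ((LC.var (LC.there (LC.there LC.here)) ∈' LC.var LC.here)
                 LC.⇒' (LC.var (LC.there LC.here) ∈' LC.var LC.here)))))
  -- ∀n (N(n) ⇔ ∀p (0 ∈ p ⇒ ∀y (N(y) ⇒ y ∈ p ⇒ S(y) ∈ p) ⇒ n ∈ p))
  natDef  : HA-Class-Ax
    (LC.∀' ι
      (cN cι LC.⇔'
        LC.∀' κ ((c0 ∈' LC.var LC.here)
          LC.⇒' LC.∀' ι (cN cι LC.⇒' (cι ∈' LC.var (LC.there LC.here))
                         LC.⇒' (cS cι ∈' LC.var (LC.there LC.here)))
          LC.⇒' (LC.var (LC.there LC.here) ∈' LC.var LC.here))))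
  compr   : ∀ ys (P : LN.Form (tt ∷ ys)) → HA-Class-Ax (comprehension ys P)
  arith   : ∀ {A} → ArithAx A → HA-Class-Ax (embF A)

module HA-Class = LC.Deduction HA-Class-Ax

-- A derivation in HA_Class uses only finitely many comprehension symbols f_{x,ȳ,P} as witnesses
-- of class quantifiers. Fix a finite list L of comprehensions containing them together with
-- {x | N x} and {x | x = y}, and read HA_Class inside HA_N: a class term f_{x,ȳ,P}(ū) stands for
-- the formula P(·, ū), so t ∈ f(ū) becomes P(t, ū), and a class quantifier ∀p A becomes the finite
-- conjunction over c ∈ L of ∀ȳ A[p := c(ȳ)] (∃p dually a finite disjunction). The translation
-- commutes with substitution, so every inference rule of HA_Class is simulated by the same rule of
-- HA_N, iterated over L and over the parameters ȳ in the case of class quantifiers.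
-- Comprehension axioms become A ⇔ A; the Leibniz definition of equality follows from the equality
-- axioms in one direction and from the class {x | x = y} in the other; the inductive definition of
-- N follows from the induction scheme in one direction and from the class {x | N x} in the other.
-- Formulas of HA_N are translated to themselves.
module Submission where

open import Data.Unit using (⊤; tt)
open import Data.Product using (_,_)
open import Data.List using (List; []; _∷_; _++_; map)
open import Data.List.Properties using (map-cong; map-id; map-∘)
open import Data.List.Membership.Propositional using (_∈_)
open import Data.List.Membership.Propositional.Properties using (∈-map⁺; ∈-map⁻)
open import Data.List.Relation.Unary.Any using (here; there)
open import Data.List.Relation.Unary.All as All using (All)
open import Data.List.Relation.Unary.All.Properties using (++⁻ˡ; ++⁻ʳ)
open import Data.List.Relation.Binary.Subset.Propositional using (_⊆_)
open import Relation.Binary.PropositionalEquality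
  using (_≡_; refl; sym; trans; cong; cong₂; subst; module ≡-Reasoning)

open import Defs

module SubstitutionLemmas (Σ : Sig) where
  open Syntax Σ

  infix 4 _≗ˢ_
  _≗ˢ_ : ∀ {Γ Δ} → Sub Γ Δ → Sub Γ Δ → Set
  σ ≗ˢ τ = ∀ {s} (v : Var _ s) → σ v ≡ τ v

  infixr 9 _⊚_
  _⊚_ : ∀ {Γ Δ Θ} → Sub Δ Θ → Sub Γ Δ → Sub Γ Θ
  (τ ⊚ σ) v = subT τ (σ v)

  toSub : ∀ {Γ Δ} → Ren Γ Δ → Sub Γ Δ
  toSub ρ v = var (ρ v)

  mutual
    subT-cong : ∀ {Γ Δ s} {σ τ : Sub Γ Δ} → σ ≗ˢ τ → (t : Term Γ s) → subT σ t ≡ subT τ t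
    subT-cong e (var v)    = e v
    subT-cong e (app f ts) = cong (app f) (subTs-cong e ts)

    subTs-cong : ∀ {Γ Δ ss} {σ τ : Sub Γ Δ} → σ ≗ˢ τ → (ts : Terms Γ ss) → subTs σ ts ≡ subTs τ ts
    subTs-cong e []       = refl
    subTs-cong e (t ∷ ts) = cong₂ _∷_ (subT-cong e t) (subTs-cong e ts)

  mutual
    subT-⊚ : ∀ {Γ Δ Θ s} (τ : Sub Δ Θ) (σ : Sub Γ Δ) (t : Term Γ s) →
      subT τ (subT σ t) ≡ subT (τ ⊚ σ) t
    subT-⊚ τ σ (var v)    = refl
    subT-⊚ τ σ (app f ts) = cong (app f) (subTs-⊚ τ σ ts)

    subTs-⊚ : ∀ {Γ Δ Θ ss} (τ : Sub Δ Θ) (σ : Sub Γ Δ) (ts : Terms Γ ss) →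
      subTs τ (subTs σ ts) ≡ subTs (τ ⊚ σ) ts
    subTs-⊚ τ σ []       = refl
    subTs-⊚ τ σ (t ∷ ts) = cong₂ _∷_ (subT-⊚ τ σ t) (subTs-⊚ τ σ ts)

  mutual
    subT-id : ∀ {Γ s} (t : Term Γ s) → subT var t ≡ t
    subT-id (var v)    = refl
    subT-id (app f ts) = cong (app f) (subTs-id ts)

    subTs-id : ∀ {Γ ss} (ts : Terms Γ ss) → subTs var ts ≡ ts
    subTs-id []       = refl
    subTs-id (t ∷ ts) = cong₂ _∷_ (subT-id t) (subTs-id ts)

  mutual
    renT≡subT : ∀ {Γ Δ s} (ρ : Ren Γ Δ) (t : Term Γ s) → renT ρ t ≡ subT (toSub ρ) t
    renT≡subT ρ (var v)    = refl
    renT≡subT ρ (app f ts) = cong (app f) (renTs≡subTs ρ ts)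

    renTs≡subTs : ∀ {Γ Δ ss} (ρ : Ren Γ Δ) (ts : Terms Γ ss) → renTs ρ ts ≡ subTs (toSub ρ) ts
    renTs≡subTs ρ []       = refl
    renTs≡subTs ρ (t ∷ ts) = cong₂ _∷_ (renT≡subT ρ t) (renTs≡subTs ρ ts)

  liftS-cong : ∀ {Γ Δ t} {σ τ : Sub Γ Δ} → σ ≗ˢ τ → liftS {t = t} σ ≗ˢ liftS τ
  liftS-cong e here      = refl
  liftS-cong e (there v) = cong (renT there) (e v)

  liftS-toSub : ∀ {Γ Δ t} (ρ : Ren Γ Δ) → toSub (liftR {t = t} ρ) ≗ˢ liftS (toSub ρ)
  liftS-toSub ρ here      = refl
  liftS-toSub ρ (there v) = refl

  mutual
    subT-renT : ∀ {Γ Δ Θ s} (σ : Sub Δ Θ) (ρ : Ren Γ Δ) (t : Term Γ s) →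
      subT σ (renT ρ t) ≡ subT (λ v → σ (ρ v)) t
    subT-renT σ ρ (var v)    = refl
    subT-renT σ ρ (app f ts) = cong (app f) (subTs-renTs σ ρ ts)

    subTs-renTs : ∀ {Γ Δ Θ ss} (σ : Sub Δ Θ) (ρ : Ren Γ Δ) (ts : Terms Γ ss) →
      subTs σ (renTs ρ ts) ≡ subTs (λ v → σ (ρ v)) ts
    subTs-renTs σ ρ []       = refl
    subTs-renTs σ ρ (t ∷ ts) = cong₂ _∷_ (subT-renT σ ρ t) (subTs-renTs σ ρ ts)

  mutual
    subT-wk : ∀ {Γ Δ s t} (σ : Sub Γ Δ) (u : Term Γ s) →
      subT (liftS {t = t} σ) (renT there u) ≡ renT there (subT σ u)
    subT-wk σ (var v)    = refl
    subT-wk σ (app f ts) = cong (app f) (subTs-wk σ ts)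

    subTs-wk : ∀ {Γ Δ ss t} (σ : Sub Γ Δ) (us : Terms Γ ss) →
      subTs (liftS {t = t} σ) (renTs there us) ≡ renTs there (subTs σ us)
    subTs-wk σ []       = refl
    subTs-wk σ (u ∷ us) = cong₂ _∷_ (subT-wk σ u) (subTs-wk σ us)

  liftS-⊚ : ∀ {Γ Δ Θ t} (τ : Sub Δ Θ) (σ : Sub Γ Δ) → liftS {t = t} τ ⊚ liftS σ ≗ˢ liftS (τ ⊚ σ)
  liftS-⊚ τ σ here      = refl
  liftS-⊚ τ σ (there v) = subT-wk τ (σ v)

  subF-cong : ∀ {Γ Δ} {σ τ : Sub Γ Δ} → σ ≗ˢ τ → (A : Form Γ) → subF σ A ≡ subF τ A
  subF-cong e (rel r ts) = cong (rel r) (subTs-cong e ts)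
  subF-cong e ⊤'         = refl
  subF-cong e ⊥'         = refl
  subF-cong e (A ∧' B)   = cong₂ _∧'_ (subF-cong e A) (subF-cong e B)
  subF-cong e (A ∨' B)   = cong₂ _∨'_ (subF-cong e A) (subF-cong e B)
  subF-cong e (A ⇒' B)   = cong₂ _⇒'_ (subF-cong e A) (subF-cong e B)
  subF-cong e (∀' s A)   = cong (∀' s) (subF-cong (liftS-cong e) A)
  subF-cong e (∃' s A)   = cong (∃' s) (subF-cong (liftS-cong e) A)

  subF-⊚ : ∀ {Γ Δ Θ} (τ : Sub Δ Θ) (σ : Sub Γ Δ) (A : Form Γ) →
    subF τ (subF σ A) ≡ subF (τ ⊚ σ) A
  subF-⊚ τ σ (rel r ts) = cong (rel r) (subTs-⊚ τ σ ts)
  subF-⊚ τ σ ⊤'         = refl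
  subF-⊚ τ σ ⊥'         = refl
  subF-⊚ τ σ (A ∧' B)   = cong₂ _∧'_ (subF-⊚ τ σ A) (subF-⊚ τ σ B)
  subF-⊚ τ σ (A ∨' B)   = cong₂ _∨'_ (subF-⊚ τ σ A) (subF-⊚ τ σ B)
  subF-⊚ τ σ (A ⇒' B)   = cong₂ _⇒'_ (subF-⊚ τ σ A) (subF-⊚ τ σ B)
  subF-⊚ τ σ (∀' s A)   =
    cong (∀' s) (trans (subF-⊚ (liftS τ) (liftS σ) A) (subF-cong (liftS-⊚ τ σ) A))
  subF-⊚ τ σ (∃' s A)   =
    cong (∃' s) (trans (subF-⊚ (liftS τ) (liftS σ) A) (subF-cong (liftS-⊚ τ σ) A))

  liftS-var : ∀ {Γ t} → liftS {t = t} (var {Γ}) ≗ˢ var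
  liftS-var here      = refl
  liftS-var (there v) = refl

  subF-id : ∀ {Γ} (A : Form Γ) → subF var A ≡ A
  subF-id (rel r ts) = cong (rel r) (subTs-id ts)
  subF-id ⊤'         = refl
  subF-id ⊥'         = refl
  subF-id (A ∧' B)   = cong₂ _∧'_ (subF-id A) (subF-id B)
  subF-id (A ∨' B)   = cong₂ _∨'_ (subF-id A) (subF-id B)
  subF-id (A ⇒' B)   = cong₂ _⇒'_ (subF-id A) (subF-id B)
  subF-id (∀' s A)   = cong (∀' s) (trans (subF-cong liftS-var A) (subF-id A))
  subF-id (∃' s A)   = cong (∃' s) (trans (subF-cong liftS-var A) (subF-id A))

  renF≡subF : ∀ {Γ Δ} (ρ : Ren Γ Δ) (A : Form Γ) → renF ρ A ≡ subF (toSub ρ) A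
  renF≡subF ρ (rel r ts) = cong (rel r) (renTs≡subTs ρ ts)
  renF≡subF ρ ⊤'         = refl
  renF≡subF ρ ⊥'         = refl
  renF≡subF ρ (A ∧' B)   = cong₂ _∧'_ (renF≡subF ρ A) (renF≡subF ρ B)
  renF≡subF ρ (A ∨' B)   = cong₂ _∨'_ (renF≡subF ρ A) (renF≡subF ρ B)
  renF≡subF ρ (A ⇒' B)   = cong₂ _⇒'_ (renF≡subF ρ A) (renF≡subF ρ B)
  renF≡subF ρ (∀' s A)   =
    cong (∀' s) (trans (renF≡subF (liftR ρ) A) (subF-cong (liftS-toSub ρ) A))
  renF≡subF ρ (∃' s A)   =
    cong (∃' s) (trans (renF≡subF (liftR ρ) A) (subF-cong (liftS-toSub ρ) A))

  subF-renF : ∀ {Γ Δ Θ} (σ : Sub Δ Θ) (ρ : Ren Γ Δ) (A : Form Γ) →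
    subF σ (renF ρ A) ≡ subF (λ v → σ (ρ v)) A
  subF-renF σ ρ A = trans (cong (subF σ) (renF≡subF ρ A)) (subF-⊚ σ (toSub ρ) A)

  renF-subF : ∀ {Γ Δ Θ} (ρ : Ren Δ Θ) (σ : Sub Γ Δ) (A : Form Γ) →
    renF ρ (subF σ A) ≡ subF (λ v → renT ρ (σ v)) A
  renF-subF ρ σ A = begin
    renF ρ (subF σ A)              ≡⟨ renF≡subF ρ (subF σ A) ⟩
    subF (toSub ρ) (subF σ A)      ≡⟨ subF-⊚ (toSub ρ) σ A ⟩
    subF (toSub ρ ⊚ σ) A           ≡⟨ subF-cong (λ v → renT≡subT ρ (σ v)) A ⟨
    subF (λ v → renT ρ (σ v)) A    ∎
    where open ≡-Reasoning

  renF-renF : ∀ {Γ Δ Θ} (ρ' : Ren Δ Θ) (ρ : Ren Γ Δ) (A : Form Γ) →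
    renF ρ' (renF ρ A) ≡ renF (λ v → ρ' (ρ v)) A
  renF-renF ρ' ρ A = begin
    renF ρ' (renF ρ A)             ≡⟨ cong (renF ρ') (renF≡subF ρ A) ⟩
    renF ρ' (subF (toSub ρ) A)     ≡⟨ renF-subF ρ' (toSub ρ) A ⟩
    subF (toSub (λ v → ρ' (ρ v))) A ≡⟨ renF≡subF (λ v → ρ' (ρ v)) A ⟨
    renF (λ v → ρ' (ρ v)) A        ∎
    where open ≡-Reasoning

  renF-id : ∀ {Γ} (A : Form Γ) → renF (λ v → v) A ≡ A
  renF-id A = trans (renF≡subF (λ v → v) A) (subF-id A)

  lookupT-renTs : ∀ {Γ Δ ss s} (i : Var ss s) (ρ : Ren Γ Δ) (ts : Terms Γ ss) →
    lookupT i (renTs ρ ts) ≡ renT ρ (lookupT i ts)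
  lookupT-renTs here      ρ (t ∷ ts) = refl
  lookupT-renTs (there i) ρ (t ∷ ts) = lookupT-renTs i ρ ts

  lookupT-subTs : ∀ {Γ Δ ss s} (i : Var ss s) (σ : Sub Γ Δ) (ts : Terms Γ ss) →
    lookupT i (subTs σ ts) ≡ subT σ (lookupT i ts)
  lookupT-subTs here      σ (t ∷ ts) = refl
  lookupT-subTs (there i) σ (t ∷ ts) = lookupT-subTs i σ ts

  fromTerms : ∀ {Γ ss} → Terms Γ ss → Sub ss Γ
  fromTerms ts i = lookupT i ts

  lookupT-varsOf : ∀ {Γ s} (i : Var Γ s) → lookupT i (varsOf Γ) ≡ var i
  lookupT-varsOf here      = refl
  lookupT-varsOf (there i) =
    trans (lookupT-renTs i there (varsOf _)) (cong (renT there) (lookupT-varsOf i))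

  infixr 5 _∷ˢ_
  _∷ˢ_ : ∀ {Γ Δ s} → Term Δ s → Sub Γ Δ → Sub (s ∷ Γ) Δ
  (u ∷ˢ σ) here      = u
  (u ∷ˢ σ) (there v) = σ v

  ∷ˢ-η : ∀ {Γ Δ s} (σ : Sub (s ∷ Γ) Δ) → σ here ∷ˢ (λ v → σ (there v)) ≗ˢ σ
  ∷ˢ-η σ here      = refl
  ∷ˢ-η σ (there v) = refl

  liftS-[] : ∀ {Γ Δ s} (σ : Sub Γ Δ) (A : Form (s ∷ Γ)) (u : Term Δ s) →
    subF (liftS σ) A [ u ] ≡ subF (u ∷ˢ σ) A
  liftS-[] σ A u = trans (subF-⊚ (σ₀ u) (liftS σ) A) (subF-cong σ₀-liftS A)
    where
    σ₀-liftS : σ₀ u ⊚ liftS σ ≗ˢ u ∷ˢ σ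
    σ₀-liftS here      = refl
    σ₀-liftS (there v) = trans (subT-renT (σ₀ u) there (σ v)) (subT-id (σ v))

  wk* : ∀ {Δ} ys → Ren Δ (ys ++ Δ)
  wk* []       v = v
  wk* (y ∷ ys) v = there (wk* ys v)

  vars* : ∀ {Δ} ys → Terms (ys ++ Δ) ys
  vars* []       = []
  vars* (y ∷ ys) = var here ∷ renTs there (vars* ys)

  σ* : ∀ {Δ ys} → Terms Δ ys → Sub (ys ++ Δ) Δ
  σ* []       = var
  σ* (u ∷ us) = u ∷ˢ σ* us

  liftS* : ∀ {Δ Θ} ys → Sub Δ Θ → Sub (ys ++ Δ) (ys ++ Θ)
  liftS* []       σ = σ
  liftS* (y ∷ ys) σ = liftS (liftS* ys σ)

  ∀* ∃* : ∀ {Δ} ys → Form (ys ++ Δ) → Form Δ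
  ∀* []       B = B
  ∀* (y ∷ ys) B = ∀* ys (∀' y B)
  ∃* []       B = B
  ∃* (y ∷ ys) B = ∃* ys (∃' y B)

  subF-∀* : ∀ {Δ Θ} (σ : Sub Δ Θ) ys (B : Form (ys ++ Δ)) →
    subF σ (∀* ys B) ≡ ∀* ys (subF (liftS* ys σ) B)
  subF-∀* σ []       B = refl
  subF-∀* σ (y ∷ ys) B = subF-∀* σ ys (∀' y B)

  subF-∃* : ∀ {Δ Θ} (σ : Sub Δ Θ) ys (B : Form (ys ++ Δ)) →
    subF σ (∃* ys B) ≡ ∃* ys (subF (liftS* ys σ) B)
  subF-∃* σ []       B = refl
  subF-∃* σ (y ∷ ys) B = subF-∃* σ ys (∃' y B)

  liftS*-wk* : ∀ {Δ Θ s} ys (σ : Sub Δ Θ) (v : Var Δ s) →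
    liftS* ys σ (wk* ys v) ≡ subT (toSub (wk* ys)) (σ v)
  liftS*-wk* []       σ v = sym (subT-id (σ v))
  liftS*-wk* (y ∷ ys) σ v = begin
    renT there (liftS* ys σ (wk* ys v))                ≡⟨ cong (renT there) (liftS*-wk* ys σ v) ⟩
    renT there (subT (toSub (wk* ys)) (σ v))           ≡⟨ renT≡subT there _ ⟩
    subT (toSub there) (subT (toSub (wk* ys)) (σ v))   ≡⟨ subT-⊚ (toSub there) (toSub (wk* ys)) (σ v) ⟩
    subT (toSub (wk* (y ∷ ys))) (σ v)                  ∎
    where open ≡-Reasoning

  liftS*-vars* : ∀ {Δ Θ} ys (σ : Sub Δ Θ) → subTs (liftS* ys σ) (vars* ys) ≡ vars* ys
  liftS*-vars* []       σ = refl
  liftS*-vars* (y ∷ ys) σ =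
    cong (var here ∷_) (trans (subTs-wk (liftS* ys σ) (vars* ys))
                              (cong (renTs there) (liftS*-vars* ys σ)))

  σ*-wk* : ∀ {Δ ys s} (us : Terms Δ ys) (v : Var Δ s) → σ* us (wk* ys v) ≡ var v
  σ*-wk* []       v = refl
  σ*-wk* (u ∷ us) v = σ*-wk* us v

  σ*-vars* : ∀ {Δ} ys (us : Terms Δ ys) → subTs (σ* us) (vars* ys) ≡ us
  σ*-vars* []       []       = refl
  σ*-vars* (y ∷ ys) (u ∷ us) =
    cong (u ∷_) (trans (subTs-renTs (σ* (u ∷ us)) there (vars* ys)) (σ*-vars* ys us))

  ⋀ ⋁ : ∀ {X : Set} {Δ} → List X → (X → Form Δ) → Form Δ
  ⋀ []       F = ⊤'
  ⋀ (c ∷ cs) F = F c ∧' ⋀ cs F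
  ⋁ []       F = ⊥'
  ⋁ (c ∷ cs) F = F c ∨' ⋁ cs F

  ⋀-cong : ∀ {X : Set} {Δ} (cs : List X) {F G : X → Form Δ} → (∀ c → F c ≡ G c) → ⋀ cs F ≡ ⋀ cs G
  ⋀-cong []       e = refl
  ⋀-cong (c ∷ cs) e = cong₂ _∧'_ (e c) (⋀-cong cs e)

  ⋁-cong : ∀ {X : Set} {Δ} (cs : List X) {F G : X → Form Δ} → (∀ c → F c ≡ G c) → ⋁ cs F ≡ ⋁ cs G
  ⋁-cong []       e = refl
  ⋁-cong (c ∷ cs) e = cong₂ _∨'_ (e c) (⋁-cong cs e)

  subF-⋀ : ∀ {X : Set} {Δ Θ} (σ : Sub Δ Θ) (cs : List X) (F : X → Form Δ) →
    subF σ (⋀ cs F) ≡ ⋀ cs (λ c → subF σ (F c))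
  subF-⋀ σ []       F = refl
  subF-⋀ σ (c ∷ cs) F = cong (subF σ (F c) ∧'_) (subF-⋀ σ cs F)

  subF-⋁ : ∀ {X : Set} {Δ Θ} (σ : Sub Δ Θ) (cs : List X) (F : X → Form Δ) →
    subF σ (⋁ cs F) ≡ ⋁ cs (λ c → subF σ (F c))
  subF-⋁ σ []       F = refl
  subF-⋁ σ (c ∷ cs) F = cong (subF σ (F c) ∨'_) (subF-⋁ σ cs F)

module DerivationLemmas (Σ : Sig) (Ax : Syntax.Form Σ [] → Set) where
  open Syntax Σ hiding (here; there)
  open Syntax Σ using () renaming (here to vz; there to vs)
  open SubstitutionLemmas Σ
  open Deduction Ax

  cast : ∀ {Γ Hs A B} → A ≡ B → Γ ⊩ Hs ⊢ A → Γ ⊩ Hs ⊢ B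
  cast refl d = d

  renF-fromEmpty : ∀ {Γ Δ} (ρ : Ren Γ Δ) (A : Form []) → renF ρ (renF fromEmpty A) ≡ renF fromEmpty A
  renF-fromEmpty ρ A = trans (renF-renF ρ fromEmpty A) (trans (renF≡subF _ A)
    (trans (subF-cong (λ ()) A) (sym (renF≡subF fromEmpty A))))

  renF-wkF : ∀ {Γ Δ t} (ρ : Ren Γ Δ) (A : Form Γ) → renF (liftR {t = t} ρ) (wkF A) ≡ wkF (renF ρ A)
  renF-wkF ρ A = trans (renF-renF (liftR ρ) vs A) (sym (renF-renF vs ρ A))

  renF-[] : ∀ {Γ Δ s} (ρ : Ren Γ Δ) (A : Form (s ∷ Γ)) (t : Term Γ s) →
    renF ρ (A [ t ]) ≡ renF (liftR ρ) A [ renT ρ t ]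
  renF-[] ρ A t = trans (renF-subF ρ (σ₀ t) A) (trans (subF-cong (λ { vz → refl ; (vs v) → refl }) A)
    (sym (subF-renF (σ₀ (renT ρ t)) (liftR ρ) A)))

  Renames : ∀ {Γ Δ} → Ren Γ Δ → List (Form Γ) → List (Form Δ) → Set
  Renames ρ Hs Hs' = ∀ {B} → B ∈ Hs → renF ρ B ∈ Hs'

  renames-∷ : ∀ {Γ Δ Hs Hs' A} {ρ : Ren Γ Δ} → Renames ρ Hs Hs' → Renames ρ (A ∷ Hs) (renF ρ A ∷ Hs')
  renames-∷ inc (here refl) = here refl
  renames-∷ inc (there m)   = there (inc m)

  renames-wkF : ∀ {Γ Δ Hs Hs' t} {ρ : Ren Γ Δ} → Renames ρ Hs Hs' →
    Renames (liftR {t = t} ρ) (map wkF Hs) (map wkF Hs')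
  renames-wkF {Hs' = Hs'} {ρ = ρ} inc m with ∈-map⁻ wkF m
  ... | B , m' , refl = subst (_∈ map wkF Hs') (sym (renF-wkF ρ B)) (∈-map⁺ wkF (inc m'))

  rename : ∀ {Γ Δ Hs Hs' A} (ρ : Ren Γ Δ) → Renames ρ Hs Hs' → Γ ⊩ Hs ⊢ A → Δ ⊩ Hs' ⊢ renF ρ A
  rename ρ inc (hyp m)          = hyp (inc m)
  rename ρ inc (ax {A = A} a)   = cast (sym (renF-fromEmpty ρ A)) (ax a)
  rename ρ inc ⊤I               = ⊤I
  rename ρ inc (⊥E d)           = ⊥E (rename ρ inc d)
  rename ρ inc (∧I d e)         = ∧I (rename ρ inc d) (rename ρ inc e)
  rename ρ inc (∧E₁ d)          = ∧E₁ (rename ρ inc d)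
  rename ρ inc (∧E₂ d)          = ∧E₂ (rename ρ inc d)
  rename ρ inc (∨I₁ d)          = ∨I₁ (rename ρ inc d)
  rename ρ inc (∨I₂ d)          = ∨I₂ (rename ρ inc d)
  rename ρ inc (∨E d e f)       =
    ∨E (rename ρ inc d) (rename ρ (renames-∷ inc) e) (rename ρ (renames-∷ inc) f)
  rename ρ inc (⇒I d)           = ⇒I (rename ρ (renames-∷ inc) d)
  rename ρ inc (⇒E d e)         = ⇒E (rename ρ inc d) (rename ρ inc e)
  rename ρ inc (∀I d)           = ∀I (rename (liftR ρ) (renames-wkF inc) d)
  rename ρ inc (∀E {A = A} d t) = cast (sym (renF-[] ρ A t)) (∀E (rename ρ inc d) (renT ρ t))
  rename ρ inc (∃I {A = A} t d) = ∃I (renT ρ t) (cast (renF-[] ρ A t) (rename ρ inc d))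
  rename ρ inc (∃E {C = C} d e) =
    ∃E (rename ρ inc d) (cast (renF-wkF ρ C) (rename (liftR ρ) (renames-∷ (renames-wkF inc)) e))

  weaken : ∀ {Γ Hs Hs' A} → Hs ⊆ Hs' → Γ ⊩ Hs ⊢ A → Γ ⊩ Hs' ⊢ A
  weaken {A = A} inc d =
    cast (renF-id A) (rename (λ v → v) (λ {B} m → subst (_∈ _) (sym (renF-id B)) (inc m)) d)

  weaken-∷ : ∀ {Γ Hs A B} → Γ ⊩ Hs ⊢ A → Γ ⊩ B ∷ Hs ⊢ A
  weaken-∷ = weaken there

  weaken-under : ∀ {Γ Hs A B C} → Γ ⊩ A ∷ Hs ⊢ C → Γ ⊩ A ∷ B ∷ Hs ⊢ C
  weaken-under = weaken λ { (here refl) → here refl ; (there m) → there (there m) }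

  weaken-wkF : ∀ {Γ Hs A t} → Γ ⊩ Hs ⊢ A → (t ∷ Γ) ⊩ map wkF Hs ⊢ wkF A
  weaken-wkF = rename vs (∈-map⁺ wkF)

  cast-hyps : ∀ {Γ Hs Hs' A B} → Hs ≡ Hs' → A ≡ B → Γ ⊩ Hs ⊢ A → Γ ⊩ Hs' ⊢ B
  cast-hyps refl refl d = d

  closeE : ∀ {Δ Hs} G (B : Form G) → Δ ⊩ Hs ⊢ renF fromEmpty (close G B) →
    (σ : Sub G Δ) → Δ ⊩ Hs ⊢ subF σ B
  closeE []      B d σ = cast (trans (renF≡subF fromEmpty B) (subF-cong (λ ()) B)) d
  closeE (s ∷ G) B d σ = cast (trans (liftS-[] _ B (σ vz)) (subF-cong (∷ˢ-η σ) B))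
    (∀E (closeE G (∀' s B) d (λ v → σ (vs v))) (σ vz))

  map-renF-id : ∀ {Γ} (Hs : List (Form Γ)) → map (renF (λ v → v)) Hs ≡ Hs
  map-renF-id Hs = trans (map-cong renF-id Hs) (map-id Hs)

  map-renF-wk* : ∀ {Δ} y ys (Hs : List (Form Δ)) →
    map (renF (wk* (y ∷ ys))) Hs ≡ map wkF (map (renF (wk* ys)) Hs)
  map-renF-wk* y ys Hs =
    trans (sym (map-cong (renF-renF vs (wk* ys)) Hs)) (map-∘ Hs)

  ∀*I : ∀ {Δ Hs} ys {B} → (ys ++ Δ) ⊩ map (renF (wk* ys)) Hs ⊢ B → Δ ⊩ Hs ⊢ ∀* ys B
  ∀*I          []       d = cast-hyps (map-renF-id _) refl d
  ∀*I {Hs = Hs} (y ∷ ys) d = ∀*I ys (∀I (cast-hyps (map-renF-wk* y ys Hs) refl d))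

  ∀*E : ∀ {Δ Hs} ys {B} → Δ ⊩ Hs ⊢ ∀* ys B → (us : Terms Δ ys) → Δ ⊩ Hs ⊢ subF (σ* us) B
  ∀*E []       {B} d []       = cast (sym (subF-id B)) d
  ∀*E (y ∷ ys) {B} d (u ∷ us) = cast (liftS-[] (σ* us) B u) (∀E (∀*E ys d us) u)

  ∃*I : ∀ {Δ Hs} ys {B} (us : Terms Δ ys) → Δ ⊩ Hs ⊢ subF (σ* us) B → Δ ⊩ Hs ⊢ ∃* ys B
  ∃*I []       {B} []       d = cast (subF-id B) d
  ∃*I (y ∷ ys) {B} (u ∷ us) d = ∃*I ys us (∃I u (cast (sym (liftS-[] (σ* us) B u)) d))

  ∃*E : ∀ {Δ Hs} ys {B C} → Δ ⊩ Hs ⊢ ∃* ys B →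
    (ys ++ Δ) ⊩ B ∷ map (renF (wk* ys)) Hs ⊢ renF (wk* ys) C → Δ ⊩ Hs ⊢ C
  ∃*E          []       {C = C} d e = ⇒E (⇒I (cast-hyps (cong (_ ∷_) (map-renF-id _)) (renF-id C) e)) d
  ∃*E {Hs = Hs} (y ∷ ys) {C = C} d e = ∃*E ys d (∃E (hyp (here refl)) (weaken-under
    (cast-hyps (cong (_ ∷_) (map-renF-wk* y ys Hs)) (sym (renF-renF vs (wk* ys) C)) e)))

  ⋀I : ∀ {X : Set} {Δ Hs} (cs : List X) {F : X → Form Δ} →
    (∀ {c} → c ∈ cs → Δ ⊩ Hs ⊢ F c) → Δ ⊩ Hs ⊢ ⋀ cs F
  ⋀I []       d = ⊤I
  ⋀I (c ∷ cs) d = ∧I (d (here refl)) (⋀I cs (λ m → d (there m)))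

  ⋀E : ∀ {X : Set} {Δ Hs} (cs : List X) {F : X → Form Δ} →
    Δ ⊩ Hs ⊢ ⋀ cs F → ∀ {c} → c ∈ cs → Δ ⊩ Hs ⊢ F c
  ⋀E (c ∷ cs) d (here refl) = ∧E₁ d
  ⋀E (c ∷ cs) d (there m)   = ⋀E cs (∧E₂ d) m

  ⋁I : ∀ {X : Set} {Δ Hs} (cs : List X) {F : X → Form Δ} →
    ∀ {c} → c ∈ cs → Δ ⊩ Hs ⊢ F c → Δ ⊩ Hs ⊢ ⋁ cs F
  ⋁I (c ∷ cs) (here refl) d = ∨I₁ d
  ⋁I (c ∷ cs) (there m)   d = ∨I₂ (⋁I cs m d)

  ⋁E : ∀ {X : Set} {Δ Hs C} (cs : List X) {F : X → Form Δ} →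
    Δ ⊩ Hs ⊢ ⋁ cs F → (∀ {c} → c ∈ cs → Δ ⊩ F c ∷ Hs ⊢ C) → Δ ⊩ Hs ⊢ C
  ⋁E []       d e = ⊥E d
  ⋁E (c ∷ cs) d e = ∨E d (e (here refl)) (⋁E cs (hyp (here refl)) (λ m → weaken-under (e (there m))))

module HA-N-Lemmas where
  open LN hiding (here; there)
  open LN using () renaming (here to vz; there to vs)
  open SubstitutionLemmas sigN
  open HA-N
  open DerivationLemmas sigN HA-N-Ax
  open NNot

  instance-of : ∀ {Δ Hs} G (B : Form G) → HA-N-Ax (close G B) → (σ : Sub G Δ) → Δ ⊩ Hs ⊢ subF σ B
  instance-of G B a = closeE G B (ax a)

  eq-refl : ∀ {Γ Hs} (t : Term Γ tt) → Γ ⊩ Hs ⊢ t `= t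
  eq-refl t = ∀E (ax (equality eqRefl)) t

  eq-sym : ∀ {Γ Hs} {a b : Term Γ tt} → Γ ⊩ Hs ⊢ a `= b → Γ ⊩ Hs ⊢ b `= a
  eq-sym {a = a} {b} d = ⇒E (⇒E (instance-of (tt ∷ tt ∷ tt ∷ []) _ (equality (eqRel eqR vz))
    (b ∷ˢ a ∷ˢ a ∷ˢ λ ())) d) (eq-refl a)

  eq-trans : ∀ {Γ Hs} {a b c : Term Γ tt} → Γ ⊩ Hs ⊢ a `= b → Γ ⊩ Hs ⊢ b `= c → Γ ⊩ Hs ⊢ a `= c
  eq-trans {a = a} {b} {c} d e = ⇒E (⇒E (instance-of (tt ∷ tt ∷ tt ∷ []) _ (equality (eqRel eqR vz))
    (a ∷ˢ b ∷ˢ c ∷ˢ λ ())) (eq-sym d)) e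

  rel-cong₁ : ∀ {Γ Hs} (r : RelN (tt ∷ [])) {a b : Term Γ tt} → Γ ⊩ Hs ⊢ a `= b →
    Γ ⊩ Hs ⊢ rel r (a ∷ []) → Γ ⊩ Hs ⊢ rel r (b ∷ [])
  rel-cong₁ r {a} {b} d e =
    ⇒E (⇒E (instance-of (tt ∷ tt ∷ []) _ (equality (eqRel r vz)) (b ∷ˢ a ∷ˢ λ ())) d) e

  app-cong₁ : ∀ {Γ Hs} (f : FunN (tt ∷ []) tt) {a b : Term Γ tt} → Γ ⊩ Hs ⊢ a `= b →
    Γ ⊩ Hs ⊢ app f (a ∷ []) `= app f (b ∷ [])
  app-cong₁ f {a} {b} d =
    ⇒E (instance-of (tt ∷ tt ∷ []) _ (equality (eqFun f vz)) (b ∷ˢ a ∷ˢ λ ())) d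

  app-cong₂ : ∀ {Γ Hs} (f : FunN (tt ∷ tt ∷ []) tt) {a b a' b' : Term Γ tt} →
    Γ ⊩ Hs ⊢ a `= a' → Γ ⊩ Hs ⊢ b `= b' → Γ ⊩ Hs ⊢ app f (a ∷ b ∷ []) `= app f (a' ∷ b' ∷ [])
  app-cong₂ f {a} {b} {a'} {b'} d e = eq-trans
    (⇒E (instance-of (tt ∷ tt ∷ tt ∷ []) _ (equality (eqFun f vz)) (a' ∷ˢ a ∷ˢ b ∷ˢ λ ())) d)
    (⇒E (instance-of (tt ∷ tt ∷ tt ∷ []) _ (equality (eqFun f (vs vz))) (b' ∷ˢ a' ∷ˢ b ∷ˢ λ ())) e)

  Equal : ∀ {G Γ} → List (Form Γ) → Sub G Γ → Sub G Γ → Set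
  Equal {Γ = Γ} Hs σ τ = ∀ {s} (v : Var _ s) → Γ ⊩ Hs ⊢ σ v `= τ v

  Equal-head : ∀ {G Γ Hs} {a b : Term Γ tt} (σ : Sub G Γ) → Γ ⊩ Hs ⊢ a `= b → Equal Hs (a ∷ˢ σ) (b ∷ˢ σ)
  Equal-head σ d vz     = d
  Equal-head σ d (vs v) = eq-refl (σ v)

  Equal-sym : ∀ {G Γ Hs} {σ τ : Sub G Γ} → Equal Hs σ τ → Equal Hs τ σ
  Equal-sym e v = eq-sym (e v)

  Equal-∷ : ∀ {G Γ Hs B} {σ τ : Sub G Γ} → Equal Hs σ τ → Equal (B ∷ Hs) σ τ
  Equal-∷ e v = weaken-∷ (e v)

  Equal-liftS : ∀ {G Γ Hs B} {σ τ : Sub G Γ} → Equal Hs σ τ →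
    Equal (B ∷ map wkF Hs) (liftS {t = tt} σ) (liftS τ)
  Equal-liftS e vz     = eq-refl (var vz)
  Equal-liftS e (vs v) = weaken-∷ (weaken-wkF (e v))

  subT-resp-eq : ∀ {G Γ Hs} {σ τ : Sub G Γ} → Equal Hs σ τ →
    (t : Term G tt) → Γ ⊩ Hs ⊢ subT σ t `= subT τ t
  subT-resp-eq e (var v)                    = e v
  subT-resp-eq e (app zeroF [])             = eq-refl _
  subT-resp-eq e (app sucF (a ∷ []))        = app-cong₁ sucF (subT-resp-eq e a)
  subT-resp-eq e (app predF (a ∷ []))       = app-cong₁ predF (subT-resp-eq e a)
  subT-resp-eq e (app plusF (a ∷ b ∷ []))   = app-cong₂ plusF (subT-resp-eq e a) (subT-resp-eq e b)
  subT-resp-eq e (app timesF (a ∷ b ∷ []))  = app-cong₂ timesF (subT-resp-eq e a) (subT-resp-eq e b)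

  lift-wk-[x0] : ∀ {Γ} (B : Form (tt ∷ Γ)) → renF (liftR vs) B [ var vz ] ≡ B
  lift-wk-[x0] B = trans (subF-renF (σ₀ (var vz)) (liftR vs) B)
    (trans (subF-cong (λ { vz → refl ; (vs v) → refl }) B) (subF-id B))

  subF-resp-eq : ∀ {G Γ Hs} {σ τ : Sub G Γ} → Equal Hs σ τ →
    (A : Form G) → Γ ⊩ Hs ⊢ subF σ A ⇒' subF τ A
  subF-resp-eq e (rel eqR (a ∷ b ∷ [])) = ⇒I (eq-trans (eq-sym (subT-resp-eq (Equal-∷ e) a))
    (eq-trans (hyp (here refl)) (subT-resp-eq (Equal-∷ e) b)))
  subF-resp-eq e (rel nullR (a ∷ []))   =
    ⇒I (rel-cong₁ nullR (subT-resp-eq (Equal-∷ e) a) (hyp (here refl)))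
  subF-resp-eq e (rel natR (a ∷ []))    =
    ⇒I (rel-cong₁ natR (subT-resp-eq (Equal-∷ e) a) (hyp (here refl)))
  subF-resp-eq e ⊤'                     = ⇒I ⊤I
  subF-resp-eq e ⊥'                     = ⇒I (hyp (here refl))
  subF-resp-eq e (A ∧' B) = ⇒I (∧I (⇒E (subF-resp-eq (Equal-∷ e) A) (∧E₁ (hyp (here refl))))
                                   (⇒E (subF-resp-eq (Equal-∷ e) B) (∧E₂ (hyp (here refl)))))
  subF-resp-eq e (A ∨' B) = ⇒I (∨E (hyp (here refl))
    (∨I₁ (⇒E (subF-resp-eq (Equal-∷ (Equal-∷ e)) A) (hyp (here refl))))
    (∨I₂ (⇒E (subF-resp-eq (Equal-∷ (Equal-∷ e)) B) (hyp (here refl)))))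
  subF-resp-eq e (A ⇒' B) = ⇒I (⇒I (⇒E (subF-resp-eq (Equal-∷ (Equal-∷ e)) B)
    (⇒E (hyp (there (here refl)))
        (⇒E (subF-resp-eq (Equal-sym (Equal-∷ (Equal-∷ e))) A) (hyp (here refl))))))
  subF-resp-eq {σ = σ} e (∀' s A) = ⇒I (∀I (⇒E (subF-resp-eq (Equal-liftS e) A)
    (cast (lift-wk-[x0] (subF (liftS σ) A)) (∀E (hyp (here refl)) (var vz)))))
  subF-resp-eq {τ = τ} e (∃' s A) = ⇒I (∃E (hyp (here refl)) (∃I (var vz)
    (cast (sym (lift-wk-[x0] (subF (liftS τ) A)))
      (⇒E (subF-resp-eq (Equal-liftS (Equal-∷ e)) A) (hyp (here refl))))))

  induction-on : ∀ {Δ Hs} (P : Form (tt ∷ Δ)) → Δ ⊩ Hs ⊢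
    P [ `0 ] ⇒' ∀x (`N x0 ⇒' P ⇒' subF (σ₀' (`S x0)) P) ⇒' ∀x (`N x0 ⇒' P)
  induction-on {Δ} P = cast (subF-id _) (instance-of Δ _ (induction Δ P) var)

module Classes where
  open LN hiding (here; there)
  open LN using () renaming (here to vz; there to vs)
  open SubstitutionLemmas sigN
  open HA-N
  open DerivationLemmas sigN HA-N-Ax
  open HA-N-Lemmas
  open NNot

  record Comprehension : Set where
    constructor ⟪_,_⟫
    field
      params : List ⊤
      body   : Form (tt ∷ params)
  open Comprehension public

  record ClassTerm (Δ : Ctx) : Set where
    constructor _⟨_⟩
    field
      comp : Comprehension
      args : Terms Δ (params comp)
  open ClassTerm public

  infix 7 _∈̇_
  _∈̇_ : ∀ {Δ} → Term Δ tt → ClassTerm Δ → Form Δ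
  x ∈̇ C = subF (x ∷ˢ fromTerms (args C)) (body (comp C))

  subC : ∀ {Δ Θ} → Sub Δ Θ → ClassTerm Δ → ClassTerm Θ
  subC σ C = comp C ⟨ subTs σ (args C) ⟩

  natClass eqClass : Comprehension
  natClass = ⟪ [] , `N x0 ⟫
  eqClass  = ⟪ tt ∷ [] , x0 `= x1 ⟫

  subC-⊚ : ∀ {Δ Θ Ξ} (τ : Sub Θ Ξ) (σ : Sub Δ Θ) (C : ClassTerm Δ) → subC τ (subC σ C) ≡ subC (τ ⊚ σ) C
  subC-⊚ τ σ C = cong (comp C ⟨_⟩) (subTs-⊚ τ σ (args C))

  subC-cong : ∀ {Δ Θ} {σ τ : Sub Δ Θ} → σ ≗ˢ τ → (C : ClassTerm Δ) → subC σ C ≡ subC τ C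
  subC-cong e C = cong (comp C ⟨_⟩) (subTs-cong e (args C))

  subC-id : ∀ {Δ} (C : ClassTerm Δ) → subC var C ≡ C
  subC-id C = cong (comp C ⟨_⟩) (subTs-id (args C))

  ∈̇-sub : ∀ {Δ Θ} (σ : Sub Δ Θ) (x : Term Δ tt) (C : ClassTerm Δ) →
    subF σ (x ∈̇ C) ≡ subT σ x ∈̇ subC σ C
  ∈̇-sub σ x C = trans (subF-⊚ σ _ (body (comp C))) (subF-cong pointwise (body (comp C)))
    where
    pointwise : σ ⊚ (x ∷ˢ fromTerms (args C)) ≗ˢ subT σ x ∷ˢ fromTerms (subTs σ (args C))
    pointwise vz     = refl
    pointwise (vs i) = sym (lookupT-subTs i σ (args C))

  x0∈̇-wk : ∀ {Δ Θ} (σ : Sub (tt ∷ Δ) Θ) (C : ClassTerm Δ) →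
    subF σ (x0 ∈̇ subC (toSub vs) C) ≡ σ vz ∈̇ subC (λ v → σ (vs v)) C
  x0∈̇-wk σ C = trans (∈̇-sub σ x0 (subC (toSub vs) C)) (cong (σ vz ∈̇_) (subC-⊚ σ (toSub vs) C))

  class-induction : ∀ {Δ Hs} (C : ClassTerm Δ) (n : Term Δ tt) →
    Δ ⊩ Hs ⊢ `0 ∈̇ C →
    Δ ⊩ Hs ⊢ ∀x (`N x0 ⇒' x0 ∈̇ subC (toSub vs) C ⇒' `S x0 ∈̇ subC (toSub vs) C) →
    Δ ⊩ Hs ⊢ `N n → Δ ⊩ Hs ⊢ n ∈̇ C
  class-induction {Δ} {Hs} C n base step n∈N =
    cast (Q-at n) (⇒E (∀E (⇒E (⇒E (induction-on Q) (cast (sym (Q-at `0)) base)) Q-step) n) n∈N)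
    where
    Q : Form (tt ∷ Δ)
    Q = x0 ∈̇ subC (toSub vs) C
    Q-at : ∀ u → Q [ u ] ≡ u ∈̇ C
    Q-at u = trans (x0∈̇-wk (σ₀ u) C) (cong (u ∈̇_) (subC-id C))
    Q-step : Δ ⊩ Hs ⊢ ∀x (`N x0 ⇒' Q ⇒' subF (σ₀' (`S x0)) Q)
    Q-step = cast (cong (λ R → ∀x (`N x0 ⇒' Q ⇒' R)) (sym (x0∈̇-wk (σ₀' (`S x0)) C))) step

  classOf : ∀ {Γ} → LC.Term Γ κ → List Comprehension
  classOf (LC.var v)               = []
  classOf (LC.app (compF ys P) ts) = ⟪ ys , P ⟫ ∷ []

  -- Only the witnesses of class quantifiers need to lie in L: every other class term is read as
  -- a formula whichever comprehension it uses.
  witnesses : ∀ {Γ Hs A} → Γ HA-Class.⊩ Hs ⊢ A → List Comprehension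
  witnesses (HA-Class.hyp m)          = []
  witnesses (HA-Class.ax a)           = []
  witnesses HA-Class.⊤I               = []
  witnesses (HA-Class.⊥E d)           = witnesses d
  witnesses (HA-Class.∧I d e)         = witnesses d ++ witnesses e
  witnesses (HA-Class.∧E₁ d)          = witnesses d
  witnesses (HA-Class.∧E₂ d)          = witnesses d
  witnesses (HA-Class.∨I₁ d)          = witnesses d
  witnesses (HA-Class.∨I₂ d)          = witnesses d
  witnesses (HA-Class.∨E d e f)       = witnesses d ++ witnesses e ++ witnesses f
  witnesses (HA-Class.⇒I d)           = witnesses d
  witnesses (HA-Class.⇒E d e)         = witnesses d ++ witnesses e
  witnesses (HA-Class.∀I d)           = witnesses d
  witnesses (HA-Class.∀E {s = ι} d t) = witnesses d
  witnesses (HA-Class.∀E {s = κ} d t) = classOf t ++ witnesses d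
  witnesses (HA-Class.∃I {s = ι} t d) = witnesses d
  witnesses (HA-Class.∃I {s = κ} t d) = classOf t ++ witnesses d
  witnesses (HA-Class.∃E d e)         = witnesses d ++ witnesses e

module Translation (L : List Classes.Comprehension)
                   (natClass∈L : Classes.natClass ∈ L) (eqClass∈L : Classes.eqClass ∈ L) where
  open LN hiding (here; there)
  open LN using () renaming (here to vz; there to vs)
  open SubstitutionLemmas sigN
  private module SC = SubstitutionLemmas sigC
  open HA-N
  open DerivationLemmas sigN HA-N-Ax
  open HA-N-Lemmas
  open Classes
  open NNot

  Val : Ctx → SortC → Set
  Val Δ ι = Term Δ tt
  Val Δ κ = ClassTerm Δ

  subV : ∀ {Δ Θ s} → Sub Δ Θ → Val Δ s → Val Θ s
  subV {s = ι} = subT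
  subV {s = κ} = subC

  subV-⊚ : ∀ {Δ Θ Ξ s} (τ : Sub Θ Ξ) (σ : Sub Δ Θ) (x : Val Δ s) → subV τ (subV σ x) ≡ subV (τ ⊚ σ) x
  subV-⊚ {s = ι} = subT-⊚
  subV-⊚ {s = κ} = subC-⊚

  subV-cong : ∀ {Δ Θ s} {σ τ : Sub Δ Θ} → σ ≗ˢ τ → (x : Val Δ s) → subV σ x ≡ subV τ x
  subV-cong {s = ι} = subT-cong
  subV-cong {s = κ} = subC-cong

  subV-id : ∀ {Δ s} (x : Val Δ s) → subV var x ≡ x
  subV-id {s = ι} = subT-id
  subV-id {s = κ} = subC-id

  Env : LC.Ctx → Ctx → Set
  Env Γ Δ = ∀ {s} → LC.Var Γ s → Val Δ s

  infixr 5 _∷ᵉ_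
  _∷ᵉ_ : ∀ {Γ Δ s} → Val Δ s → Env Γ Δ → Env (s ∷ Γ) Δ
  (x ∷ᵉ ρ) LC.here      = x
  (x ∷ᵉ ρ) (LC.there v) = ρ v

  subE : ∀ {Γ Δ Θ} → Sub Δ Θ → Env Γ Δ → Env Γ Θ
  subE σ ρ v = subV σ (ρ v)

  infix 4 _≗ᵉ_
  _≗ᵉ_ : ∀ {Γ Δ} → Env Γ Δ → Env Γ Δ → Set
  ρ ≗ᵉ ρ' = ∀ {s} (v : LC.Var _ s) → ρ v ≡ ρ' v

  bind : ∀ {Γ Δ s} ys → Env Γ Δ → Val (ys ++ Δ) s → Env (s ∷ Γ) (ys ++ Δ)
  bind ys ρ x = x ∷ᵉ subE (toSub (wk* ys)) ρ

  generic : ∀ {Δ} (c : Comprehension) → ClassTerm (params c ++ Δ)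
  generic c = c ⟨ vars* (params c) ⟩

  mutual
    trT : ∀ {Γ Δ s} → Env Γ Δ → LC.Term Γ s → Val Δ s
    trT ρ (LC.var v)                 = ρ v
    trT ρ (LC.app (baseF {ss} f) ts) = app f (trTs ss ρ ts)
    trT ρ (LC.app (compF ys P) ts)   = ⟪ ys , P ⟫ ⟨ trTs ys ρ ts ⟩

    trTs : ∀ {Γ Δ} ss → Env Γ Δ → LC.Terms Γ (ιs ss) → Terms Δ ss
    trTs []       ρ LC.[]       = []
    trTs (s ∷ ss) ρ (t LC.∷ ts) = trT ρ t ∷ trTs ss ρ ts

  trF : ∀ {Γ Δ} → Env Γ Δ → LC.Form Γ → Form Δ
  trF ρ (LC.rel (baseR {ss} r) ts)             = rel r (trTs ss ρ ts)
  trF ρ (LC.rel memR (t LC.∷ (p LC.∷ LC.[]))) = trT ρ t ∈̇ trT ρ p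
  trF ρ LC.⊤'       = ⊤'
  trF ρ LC.⊥'       = ⊥'
  trF ρ (A LC.∧' B) = trF ρ A ∧' trF ρ B
  trF ρ (A LC.∨' B) = trF ρ A ∨' trF ρ B
  trF ρ (A LC.⇒' B) = trF ρ A ⇒' trF ρ B
  trF ρ (LC.∀' ι A) = ∀' tt (trF (bind (tt ∷ []) ρ (var vz)) A)
  trF ρ (LC.∃' ι A) = ∃' tt (trF (bind (tt ∷ []) ρ (var vz)) A)
  trF ρ (LC.∀' κ A) = ⋀ L (λ c → ∀* (params c) (trF (bind (params c) ρ (generic c)) A))
  trF ρ (LC.∃' κ A) = ⋁ L (λ c → ∃* (params c) (trF (bind (params c) ρ (generic c)) A))

  mutual
    trT-cong : ∀ {Γ Δ s} {ρ ρ' : Env Γ Δ} → ρ ≗ᵉ ρ' → (t : LC.Term Γ s) → trT ρ t ≡ trT ρ' t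
    trT-cong e (LC.var v)                 = e v
    trT-cong e (LC.app (baseF {ss} f) ts) = cong (app f) (trTs-cong e ss ts)
    trT-cong e (LC.app (compF ys P) ts)   = cong (⟪ ys , P ⟫ ⟨_⟩) (trTs-cong e ys ts)

    trTs-cong : ∀ {Γ Δ} {ρ ρ' : Env Γ Δ} → ρ ≗ᵉ ρ' → ∀ ss (ts : LC.Terms Γ (ιs ss)) →
      trTs ss ρ ts ≡ trTs ss ρ' ts
    trTs-cong e []       LC.[]       = refl
    trTs-cong e (s ∷ ss) (t LC.∷ ts) = cong₂ _∷_ (trT-cong e t) (trTs-cong e ss ts)

  bind-cong : ∀ {Γ Δ s} ys {ρ ρ' : Env Γ Δ} {x : Val (ys ++ Δ) s} → ρ ≗ᵉ ρ' → bind ys ρ x ≗ᵉ bind ys ρ' x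
  bind-cong ys e LC.here      = refl
  bind-cong ys e (LC.there v) = cong (subV _) (e v)

  trF-cong : ∀ {Γ Δ} {ρ ρ' : Env Γ Δ} → ρ ≗ᵉ ρ' → (A : LC.Form Γ) → trF ρ A ≡ trF ρ' A
  trF-cong e (LC.rel (baseR {ss} r) ts)             = cong (rel r) (trTs-cong e ss ts)
  trF-cong e (LC.rel memR (t LC.∷ (p LC.∷ LC.[]))) = cong₂ _∈̇_ (trT-cong e t) (trT-cong e p)
  trF-cong e LC.⊤'       = refl
  trF-cong e LC.⊥'       = refl
  trF-cong e (A LC.∧' B) = cong₂ _∧'_ (trF-cong e A) (trF-cong e B)
  trF-cong e (A LC.∨' B) = cong₂ _∨'_ (trF-cong e A) (trF-cong e B)
  trF-cong e (A LC.⇒' B) = cong₂ _⇒'_ (trF-cong e A) (trF-cong e B)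
  trF-cong e (LC.∀' ι A) = cong (∀' tt) (trF-cong (bind-cong (tt ∷ []) e) A)
  trF-cong e (LC.∃' ι A) = cong (∃' tt) (trF-cong (bind-cong (tt ∷ []) e) A)
  trF-cong e (LC.∀' κ A) = ⋀-cong L λ c → cong (∀* (params c)) (trF-cong (bind-cong (params c) e) A)
  trF-cong e (LC.∃' κ A) = ⋁-cong L λ c → cong (∃* (params c)) (trF-cong (bind-cong (params c) e) A)

  mutual
    trT-sub : ∀ {Γ Δ Θ s} (σ : Sub Δ Θ) (ρ : Env Γ Δ) (t : LC.Term Γ s) →
      subV σ (trT ρ t) ≡ trT (subE σ ρ) t
    trT-sub σ ρ (LC.var v)                 = refl
    trT-sub σ ρ (LC.app (baseF {ss} f) ts) = cong (app f) (trTs-sub σ ρ ss ts)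
    trT-sub σ ρ (LC.app (compF ys P) ts)   = cong (⟪ ys , P ⟫ ⟨_⟩) (trTs-sub σ ρ ys ts)

    trTs-sub : ∀ {Γ Δ Θ} (σ : Sub Δ Θ) (ρ : Env Γ Δ) ss (ts : LC.Terms Γ (ιs ss)) →
      subTs σ (trTs ss ρ ts) ≡ trTs ss (subE σ ρ) ts
    trTs-sub σ ρ []       LC.[]       = refl
    trTs-sub σ ρ (s ∷ ss) (t LC.∷ ts) = cong₂ _∷_ (trT-sub σ ρ t) (trTs-sub σ ρ ss ts)

  bind-sub : ∀ {Γ Δ Θ s} ys (σ : Sub Δ Θ) (ρ : Env Γ Δ) (x : Val (ys ++ Δ) s) →
    subE (liftS* ys σ) (bind ys ρ x) ≗ᵉ bind ys (subE σ ρ) (subV (liftS* ys σ) x)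
  bind-sub ys σ ρ x LC.here      = refl
  bind-sub ys σ ρ x (LC.there v) = begin
    subV (liftS* ys σ) (subV (toSub (wk* ys)) (ρ v))   ≡⟨ subV-⊚ (liftS* ys σ) (toSub (wk* ys)) (ρ v) ⟩
    subV (liftS* ys σ ⊚ toSub (wk* ys)) (ρ v)         ≡⟨ subV-cong (liftS*-wk* ys σ) (ρ v) ⟩
    subV (toSub (wk* ys) ⊚ σ) (ρ v)                   ≡⟨ subV-⊚ (toSub (wk* ys)) σ (ρ v) ⟨
    subV (toSub (wk* ys)) (subV σ (ρ v))              ∎
    where open ≡-Reasoning

  generic-sub : ∀ {Δ Θ} (c : Comprehension) (σ : Sub Δ Θ) →
    subC (liftS* (params c) σ) (generic c) ≡ generic c
  generic-sub c σ = cong (c ⟨_⟩) (liftS*-vars* (params c) σ)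

  mutual
    trF-sub : ∀ {Γ Δ Θ} (σ : Sub Δ Θ) (ρ : Env Γ Δ) (A : LC.Form Γ) →
      subF σ (trF ρ A) ≡ trF (subE σ ρ) A
    trF-sub σ ρ (LC.rel (baseR {ss} r) ts)             = cong (rel r) (trTs-sub σ ρ ss ts)
    trF-sub σ ρ (LC.rel memR (t LC.∷ (p LC.∷ LC.[]))) =
      trans (∈̇-sub σ (trT ρ t) (trT ρ p)) (cong₂ _∈̇_ (trT-sub σ ρ t) (trT-sub σ ρ p))
    trF-sub σ ρ LC.⊤'       = refl
    trF-sub σ ρ LC.⊥'       = refl
    trF-sub σ ρ (A LC.∧' B) = cong₂ _∧'_ (trF-sub σ ρ A) (trF-sub σ ρ B)
    trF-sub σ ρ (A LC.∨' B) = cong₂ _∨'_ (trF-sub σ ρ A) (trF-sub σ ρ B)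
    trF-sub σ ρ (A LC.⇒' B) = cong₂ _⇒'_ (trF-sub σ ρ A) (trF-sub σ ρ B)
    trF-sub σ ρ (LC.∀' ι A) = cong (∀' tt) (trF-sub-bind (tt ∷ []) σ ρ refl A)
    trF-sub σ ρ (LC.∃' ι A) = cong (∃' tt) (trF-sub-bind (tt ∷ []) σ ρ refl A)
    trF-sub σ ρ (LC.∀' κ A) = trans (subF-⋀ σ L _) (⋀-cong L λ c →
      trans (subF-∀* σ (params c) _)
            (cong (∀* (params c)) (trF-sub-bind (params c) σ ρ (generic-sub c σ) A)))
    trF-sub σ ρ (LC.∃' κ A) = trans (subF-⋁ σ L _) (⋁-cong L λ c →
      trans (subF-∃* σ (params c) _)
            (cong (∃* (params c)) (trF-sub-bind (params c) σ ρ (generic-sub c σ) A)))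

    trF-sub-bind : ∀ {Γ Δ Θ s} ys (σ : Sub Δ Θ) (ρ : Env Γ Δ) {x : Val (ys ++ Δ) s} {y} →
      subV (liftS* ys σ) x ≡ y → (A : LC.Form (s ∷ Γ)) →
      subF (liftS* ys σ) (trF (bind ys ρ x) A) ≡ trF (bind ys (subE σ ρ) y) A
    trF-sub-bind ys σ ρ {x} refl A =
      trans (trF-sub (liftS* ys σ) (bind ys ρ x) A) (trF-cong (bind-sub ys σ ρ x) A)

  infixr 9 _⋆_
  _⋆_ : ∀ {Γ Γ' Δ} → LC.Sub Γ Γ' → Env Γ' Δ → Env Γ Δ
  (σ ⋆ ρ) v = trT ρ (σ v)

  mutual
    trT-subT : ∀ {Γ Γ' Δ s} (ρ : Env Γ' Δ) (σ : LC.Sub Γ Γ') (t : LC.Term Γ s) →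
      trT ρ (LC.subT σ t) ≡ trT (σ ⋆ ρ) t
    trT-subT ρ σ (LC.var v)                 = refl
    trT-subT ρ σ (LC.app (baseF {ss} f) ts) = cong (app f) (trTs-subTs ρ σ ss ts)
    trT-subT ρ σ (LC.app (compF ys P) ts)   = cong (⟪ ys , P ⟫ ⟨_⟩) (trTs-subTs ρ σ ys ts)

    trTs-subTs : ∀ {Γ Γ' Δ} (ρ : Env Γ' Δ) (σ : LC.Sub Γ Γ') ss (ts : LC.Terms Γ (ιs ss)) →
      trTs ss ρ (LC.subTs σ ts) ≡ trTs ss (σ ⋆ ρ) ts
    trTs-subTs ρ σ []       LC.[]       = refl
    trTs-subTs ρ σ (s ∷ ss) (t LC.∷ ts) = cong₂ _∷_ (trT-subT ρ σ t) (trTs-subTs ρ σ ss ts)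

  trT-renT : ∀ {Γ Γ' Δ s} (ρ : Env Γ' Δ) (r : LC.Ren Γ Γ') (t : LC.Term Γ s) →
    trT ρ (LC.renT r t) ≡ trT (λ v → ρ (r v)) t
  trT-renT ρ r t = trans (cong (trT ρ) (SC.renT≡subT r t)) (trT-subT ρ (SC.toSub r) t)

  bind-⋆ : ∀ {Γ Γ' Δ s} ys (σ : LC.Sub Γ Γ') (ρ : Env Γ' Δ) (x : Val (ys ++ Δ) s) →
    LC.liftS σ ⋆ bind ys ρ x ≗ᵉ bind ys (σ ⋆ ρ) x
  bind-⋆ ys σ ρ x LC.here      = refl
  bind-⋆ ys σ ρ x (LC.there v) =
    trans (trT-renT (bind ys ρ x) LC.there (σ v)) (sym (trT-sub (toSub (wk* ys)) ρ (σ v)))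

  trF-subF : ∀ {Γ Γ' Δ} (ρ : Env Γ' Δ) (σ : LC.Sub Γ Γ') (A : LC.Form Γ) →
    trF ρ (LC.subF σ A) ≡ trF (σ ⋆ ρ) A
  trF-subF ρ σ (LC.rel (baseR {ss} r) ts)             = cong (rel r) (trTs-subTs ρ σ ss ts)
  trF-subF ρ σ (LC.rel memR (t LC.∷ (p LC.∷ LC.[]))) = cong₂ _∈̇_ (trT-subT ρ σ t) (trT-subT ρ σ p)
  trF-subF ρ σ LC.⊤'       = refl
  trF-subF ρ σ LC.⊥'       = refl
  trF-subF ρ σ (A LC.∧' B) = cong₂ _∧'_ (trF-subF ρ σ A) (trF-subF ρ σ B)
  trF-subF ρ σ (A LC.∨' B) = cong₂ _∨'_ (trF-subF ρ σ A) (trF-subF ρ σ B)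
  trF-subF ρ σ (A LC.⇒' B) = cong₂ _⇒'_ (trF-subF ρ σ A) (trF-subF ρ σ B)
  trF-subF ρ σ (LC.∀' ι A) =
    cong (∀' tt) (trans (trF-subF _ (LC.liftS σ) A) (trF-cong (bind-⋆ (tt ∷ []) σ ρ _) A))
  trF-subF ρ σ (LC.∃' ι A) =
    cong (∃' tt) (trans (trF-subF _ (LC.liftS σ) A) (trF-cong (bind-⋆ (tt ∷ []) σ ρ _) A))
  trF-subF ρ σ (LC.∀' κ A) = ⋀-cong L λ c →
    cong (∀* (params c)) (trans (trF-subF _ (LC.liftS σ) A) (trF-cong (bind-⋆ (params c) σ ρ _) A))
  trF-subF ρ σ (LC.∃' κ A) = ⋁-cong L λ c →
    cong (∃* (params c)) (trans (trF-subF _ (LC.liftS σ) A) (trF-cong (bind-⋆ (params c) σ ρ _) A))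

  trF-renF : ∀ {Γ Γ' Δ} (ρ : Env Γ' Δ) (r : LC.Ren Γ Γ') (A : LC.Form Γ) →
    trF ρ (LC.renF r A) ≡ trF (λ v → ρ (r v)) A
  trF-renF ρ r A = trans (cong (trF ρ) (SC.renF≡subF r A)) (trF-subF ρ (SC.toSub r) A)

  trF-[] : ∀ {Γ Δ s} (ρ : Env Γ Δ) (A : LC.Form (s ∷ Γ)) (t : LC.Term Γ s) →
    trF ρ (A LC.[ t ]) ≡ trF (trT ρ t ∷ᵉ ρ) A
  trF-[] ρ A t = trans (trF-subF ρ (LC.σ₀ t) A) (trF-cong (λ { LC.here → refl ; (LC.there v) → refl }) A)

  trF-σ*-bind : ∀ {Γ Δ s} ys (us : Terms Δ ys) (ρ : Env Γ Δ) {x : Val (ys ++ Δ) s} {y} →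
    subV (σ* us) x ≡ y → (A : LC.Form (s ∷ Γ)) → subF (σ* us) (trF (bind ys ρ x) A) ≡ trF (y ∷ᵉ ρ) A
  trF-σ*-bind ys us ρ {x} refl A = trans (trF-sub (σ* us) (bind ys ρ x) A) (trF-cong unshift A)
    where
    unshift : subE (σ* us) (bind ys ρ x) ≗ᵉ subV (σ* us) x ∷ᵉ ρ
    unshift LC.here      = refl
    unshift (LC.there v) = trans (subV-⊚ (σ* us) (toSub (wk* ys)) (ρ v))
                                 (trans (subV-cong (σ*-wk* us) (ρ v)) (subV-id (ρ v)))

  generic-σ* : ∀ {Δ} (C : ClassTerm Δ) → subC (σ* (args C)) (generic (comp C)) ≡ C
  generic-σ* C = cong (comp C ⟨_⟩) (σ*-vars* (params (comp C)) (args C))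

  trF-wkF-bind : ∀ {Γ Δ s} ys (ρ : Env Γ Δ) (x : Val (ys ++ Δ) s) (H : LC.Form Γ) →
    trF (bind ys ρ x) (LC.wkF H) ≡ renF (wk* ys) (trF ρ H)
  trF-wkF-bind ys ρ x H = begin
    trF (bind ys ρ x) (LC.wkF H)        ≡⟨ trF-renF (bind ys ρ x) LC.there H ⟩
    trF (subE (toSub (wk* ys)) ρ) H     ≡⟨ trF-sub (toSub (wk* ys)) ρ H ⟨
    subF (toSub (wk* ys)) (trF ρ H)     ≡⟨ renF≡subF (wk* ys) (trF ρ H) ⟨
    renF (wk* ys) (trF ρ H)             ∎
    where open ≡-Reasoning

  map-trF-wkF-bind : ∀ {Γ Δ s} ys (ρ : Env Γ Δ) (x : Val (ys ++ Δ) s) (Hs : List (LC.Form Γ)) →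
    map (trF (bind ys ρ x)) (map LC.wkF Hs) ≡ map (renF (wk* ys)) (map (trF ρ) Hs)
  map-trF-wkF-bind ys ρ x Hs =
    trans (sym (map-∘ Hs)) (trans (map-cong (trF-wkF-bind ys ρ x) Hs) (map-∘ Hs))

  mutual
    trT-embT : ∀ {G Δ} (ρ : Env (ιs G) Δ) (t : Term G tt) → trT ρ (embT t) ≡ subT (λ v → ρ (embV v)) t
    trT-embT ρ (var v)    = refl
    trT-embT ρ (app f ts) = cong (app f) (trTs-embTs ρ ts)

    trTs-embTs : ∀ {G Δ ss} (ρ : Env (ιs G) Δ) (ts : Terms G ss) →
      trTs ss ρ (embTs ts) ≡ subTs (λ v → ρ (embV v)) ts
    trTs-embTs ρ []       = refl
    trTs-embTs ρ (t ∷ ts) = cong₂ _∷_ (trT-embT ρ t) (trTs-embTs ρ ts)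

  bind-embV : ∀ {G Δ} (ρ : Env (ιs G) Δ) →
    (λ v → bind (tt ∷ []) ρ (var vz) (embV v)) ≗ˢ liftS {t = tt} (λ v → ρ (embV v))
  bind-embV ρ vz     = refl
  bind-embV ρ (vs v) = sym (renT≡subT vs (ρ (embV v)))

  trF-embF : ∀ {G Δ} (ρ : Env (ιs G) Δ) (A : Form G) → trF ρ (embF A) ≡ subF (λ v → ρ (embV v)) A
  trF-embF ρ (rel r ts) = cong (rel r) (trTs-embTs ρ ts)
  trF-embF ρ ⊤'         = refl
  trF-embF ρ ⊥'         = refl
  trF-embF ρ (A ∧' B)   = cong₂ _∧'_ (trF-embF ρ A) (trF-embF ρ B)
  trF-embF ρ (A ∨' B)   = cong₂ _∨'_ (trF-embF ρ A) (trF-embF ρ B)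
  trF-embF ρ (A ⇒' B)   = cong₂ _⇒'_ (trF-embF ρ A) (trF-embF ρ B)
  trF-embF ρ (∀' s A)   = cong (∀' tt) (trans (trF-embF _ A) (subF-cong (bind-embV ρ) A))
  trF-embF ρ (∃' s A)   = cong (∃' tt) (trans (trF-embF _ A) (subF-cong (bind-embV ρ) A))

  ∀E-ι : ∀ {Γ Δ Hs} (ρ : Env Γ Δ) (A : LC.Form (ι ∷ Γ)) (t : LC.Term Γ ι) →
    Δ ⊩ Hs ⊢ trF ρ (LC.∀' ι A) → Δ ⊩ Hs ⊢ trF ρ (A LC.[ t ])
  ∀E-ι ρ A t d =
    cast (trans (trF-σ*-bind (tt ∷ []) (trT ρ t ∷ []) ρ refl A) (sym (trF-[] ρ A t)))
      (∀*E (tt ∷ []) d (trT ρ t ∷ []))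

  ∀E-κ : ∀ {Γ Δ Hs} (ρ : Env Γ Δ) (A : LC.Form (κ ∷ Γ)) (t : LC.Term Γ κ) → comp (trT ρ t) ∈ L →
    Δ ⊩ Hs ⊢ trF ρ (LC.∀' κ A) → Δ ⊩ Hs ⊢ trF ρ (A LC.[ t ])
  ∀E-κ {Δ = Δ} ρ A t m d =
    cast (trans (trF-σ*-bind (params (comp C)) (args C) ρ (generic-σ* C) A) (sym (trF-[] ρ A t)))
      (∀*E (params (comp C)) (⋀E L d m) (args C))
    where
    C : ClassTerm Δ
    C = trT ρ t

  ∃I-ι : ∀ {Γ Δ Hs} (ρ : Env Γ Δ) (A : LC.Form (ι ∷ Γ)) (t : LC.Term Γ ι) →
    Δ ⊩ Hs ⊢ trF ρ (A LC.[ t ]) → Δ ⊩ Hs ⊢ trF ρ (LC.∃' ι A)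
  ∃I-ι ρ A t d = ∃*I (tt ∷ []) (trT ρ t ∷ [])
    (cast (trans (trF-[] ρ A t) (sym (trF-σ*-bind (tt ∷ []) (trT ρ t ∷ []) ρ refl A))) d)

  ∃I-κ : ∀ {Γ Δ Hs} (ρ : Env Γ Δ) (A : LC.Form (κ ∷ Γ)) (t : LC.Term Γ κ) → comp (trT ρ t) ∈ L →
    Δ ⊩ Hs ⊢ trF ρ (A LC.[ t ]) → Δ ⊩ Hs ⊢ trF ρ (LC.∃' κ A)
  ∃I-κ {Δ = Δ} ρ A t m d = ⋁I L m (∃*I (params (comp C)) (args C)
    (cast (trans (trF-[] ρ A t) (sym (trF-σ*-bind (params (comp C)) (args C) ρ (generic-σ* C) A))) d))
    where
    C : ClassTerm Δ
    C = trT ρ t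

  Admissible : ∀ {Γ Δ} → Env Γ Δ → Set
  Admissible ρ = ∀ (v : LC.Var _ κ) → comp (ρ v) ∈ L

  admissible-bindι : ∀ {Γ Δ} ys {ρ : Env Γ Δ} {t : Term (ys ++ Δ) tt} →
    Admissible ρ → Admissible (bind ys ρ t)
  admissible-bindι ys adm (LC.there v) = adm v

  admissible-bindκ : ∀ {Γ Δ} ys {ρ : Env Γ Δ} {C : ClassTerm (ys ++ Δ)} →
    comp C ∈ L → Admissible ρ → Admissible (bind ys ρ C)
  admissible-bindκ ys m adm LC.here      = m
  admissible-bindκ ys m adm (LC.there v) = adm v

  classOf-∈ : ∀ {Γ Δ} {ρ : Env Γ Δ} → Admissible ρ → (t : LC.Term Γ κ) →
    All (_∈ L) (classOf t) → comp (trT ρ t) ∈ L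
  classOf-∈ adm (LC.var v)               ok = adm v
  classOf-∈ adm (LC.app (compF ys P) ts) ok = All.head ok

  lookupT-trTs : ∀ {Γ Δ} ys (i : Var ys tt) (ρ : Env Γ Δ) (ts : LC.Terms Γ (ιs ys)) →
    lookupT i (trTs ys ρ ts) ≡ trT ρ (LC.lookupT (embV i) ts)
  lookupT-trTs (y ∷ ys) vz     ρ (t LC.∷ ts) = refl
  lookupT-trTs (y ∷ ys) (vs i) ρ (t LC.∷ ts) = lookupT-trTs ys i ρ ts

  envOf : ∀ {Δ} zs → Env [] Δ → Env (ιs zs) (zs ++ Δ)
  envOf []       ρ = ρ
  envOf (z ∷ zs) ρ = bind (tt ∷ []) (envOf zs ρ) (var vz)

  closeI : ∀ {Δ Hs} zs (B : LC.Form (ιs zs)) (ρ : Env [] Δ) →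
    (∀ {Hs'} → (zs ++ Δ) ⊩ Hs' ⊢ trF (envOf zs ρ) B) → Δ ⊩ Hs ⊢ trF ρ (LC.close (ιs zs) B)
  closeI []       B ρ d = d
  closeI (z ∷ zs) B ρ d = closeI zs (LC.∀' ι B) ρ (∀I d)

  ⇔-refl : ∀ {Γ Hs} {A B : Form Γ} → A ≡ B → Γ ⊩ Hs ⊢ A ⇔' B
  ⇔-refl refl = ∧I (⇒I (hyp (here refl))) (⇒I (hyp (here refl)))

  axiom-valid : ∀ {Δ Hs A} → HA-Class-Ax A → (ρ : Env [] Δ) → Δ ⊩ Hs ⊢ trF ρ A
  axiom-valid leibniz ρ = ∀I (∀I (∧I
    (⇒I (⋀I L λ {c} _ → ∀*I (params c)
      (subF-resp-eq (Equal-head (fromTerms (vars* (params c))) (hyp (here refl))) (body c))))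
    (⇒I (eq-sym (⇒E (∀*E (tt ∷ []) (⋀E L (hyp (here refl)) eqClass∈L) (var (vs vz) ∷ []))
                    (eq-refl _))))))
  axiom-valid natDef ρ = ∀I (∧I
    (⇒I (⋀I L λ {c} _ → ∀*I (params c) (⇒I (⇒I
      (class-induction (generic c) _ (hyp (there (here refl))) (hyp (here refl))
                       (hyp (there (there (here refl)))))))))
    (⇒I (⇒E (⇒E (⋀E L (hyp (here refl)) natClass∈L) (ax nat0))
            (∀I (⇒I (⇒I (⇒E (∀E (ax natS) (var vz)) (hyp (there (here refl))))))))))
  axiom-valid {Δ} (compr ys P) ρ = closeI (tt ∷ ys) _ ρ (⇔-refl
    (trans (subF-cong comprehension-args P) (sym (trF-embF ρ' P))))
    where
    ρ' : Env (ιs (tt ∷ ys)) (tt ∷ ys ++ Δ)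
    ρ' = envOf (tt ∷ ys) ρ
    comprehension-args : var vz ∷ˢ fromTerms (trTs ys ρ' (LC.renTs LC.there (LC.varsOf (ιs ys))))
                         ≗ˢ (λ v → ρ' (embV v))
    comprehension-args vz     = refl
    comprehension-args (vs i) = trans (lookupT-trTs ys i ρ' _) (cong (trT ρ')
      (trans (SC.lookupT-renTs (embV i) LC.there (LC.varsOf (ιs ys)))
             (cong (LC.renT LC.there) (SC.lookupT-varsOf (embV i)))))
  axiom-valid (arith {A} a) ρ = cast (sym (begin
    trF ρ (embF A)                  ≡⟨ trF-embF ρ A ⟩
    subF (λ v → ρ (embV v)) A       ≡⟨ subF-cong (λ ()) A ⟩
    subF (toSub fromEmpty) A        ≡⟨ renF≡subF fromEmpty A ⟨
    renF fromEmpty A                ∎)) (ax (arith a))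
    where open ≡-Reasoning

  translate : ∀ {Γ Hs A} (d : Γ HA-Class.⊩ Hs ⊢ A) → All (_∈ L) (witnesses d) →
    ∀ {Δ} (ρ : Env Γ Δ) → Admissible ρ → Δ ⊩ map (trF ρ) Hs ⊢ trF ρ A
  translate (HA-Class.hyp m)        ok ρ adm = hyp (∈-map⁺ (trF ρ) m)
  translate (HA-Class.ax {A = A} a) ok ρ adm =
    cast (sym (trF-renF ρ LC.fromEmpty A)) (axiom-valid a (λ v → ρ (LC.fromEmpty v)))
  translate HA-Class.⊤I             ok ρ adm = ⊤I
  translate (HA-Class.⊥E d)         ok ρ adm = ⊥E (translate d ok ρ adm)
  translate (HA-Class.∧I d e)       ok ρ adm =
    ∧I (translate d (++⁻ˡ _ ok) ρ adm) (translate e (++⁻ʳ _ ok) ρ adm)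
  translate (HA-Class.∧E₁ d)        ok ρ adm = ∧E₁ (translate d ok ρ adm)
  translate (HA-Class.∧E₂ d)        ok ρ adm = ∧E₂ (translate d ok ρ adm)
  translate (HA-Class.∨I₁ d)        ok ρ adm = ∨I₁ (translate d ok ρ adm)
  translate (HA-Class.∨I₂ d)        ok ρ adm = ∨I₂ (translate d ok ρ adm)
  translate (HA-Class.∨E d e f)     ok ρ adm = ∨E (translate d (++⁻ˡ _ ok) ρ adm)
    (translate e (++⁻ˡ _ (++⁻ʳ (witnesses d) ok)) ρ adm)
    (translate f (++⁻ʳ (witnesses e) (++⁻ʳ (witnesses d) ok)) ρ adm)
  translate (HA-Class.⇒I d)         ok ρ adm = ⇒I (translate d ok ρ adm)
  translate (HA-Class.⇒E d e)       ok ρ adm =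
    ⇒E (translate d (++⁻ˡ _ ok) ρ adm) (translate e (++⁻ʳ _ ok) ρ adm)
  translate (HA-Class.∀I {Hs = Hs} {s = ι} d) ok ρ adm =
    ∀*I (tt ∷ []) (cast-hyps (map-trF-wkF-bind (tt ∷ []) ρ (var vz) Hs) refl
      (translate d ok _ (admissible-bindι (tt ∷ []) adm)))
  translate (HA-Class.∀I {Hs = Hs} {s = κ} d) ok ρ adm = ⋀I L λ {c} c∈L →
    ∀*I (params c) (cast-hyps (map-trF-wkF-bind (params c) ρ (generic c) Hs) refl
      (translate d ok _ (admissible-bindκ (params c) c∈L adm)))
  translate (HA-Class.∀E {s = ι} {A = A} d t) ok ρ adm = ∀E-ι ρ A t (translate d ok ρ adm)
  translate (HA-Class.∀E {s = κ} {A = A} d t) ok ρ adm =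
    ∀E-κ ρ A t (classOf-∈ adm t (++⁻ˡ (classOf t) ok)) (translate d (++⁻ʳ (classOf t) ok) ρ adm)
  translate (HA-Class.∃I {s = ι} {A = A} t d) ok ρ adm = ∃I-ι ρ A t (translate d ok ρ adm)
  translate (HA-Class.∃I {s = κ} {A = A} t d) ok ρ adm =
    ∃I-κ ρ A t (classOf-∈ adm t (++⁻ˡ (classOf t) ok)) (translate d (++⁻ʳ (classOf t) ok) ρ adm)
  translate (HA-Class.∃E {Hs = Hs} {s = ι} {C = C} d e) ok ρ adm =
    ∃*E (tt ∷ []) (translate d (++⁻ˡ _ ok) ρ adm)
      (cast-hyps (cong (_ ∷_) (map-trF-wkF-bind (tt ∷ []) ρ (var vz) Hs))
                 (trF-wkF-bind (tt ∷ []) ρ (var vz) C)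
        (translate e (++⁻ʳ (witnesses d) ok) _ (admissible-bindι (tt ∷ []) adm)))
  translate (HA-Class.∃E {Hs = Hs} {s = κ} {C = C} d e) ok ρ adm =
    ⋁E L (translate d (++⁻ˡ _ ok) ρ adm) λ {c} c∈L → ∃*E (params c) (hyp (here refl)) (weaken-under
      (cast-hyps (cong (_ ∷_) (map-trF-wkF-bind (params c) ρ (generic c) Hs))
                 (trF-wkF-bind (params c) ρ (generic c) C)
        (translate e (++⁻ʳ (witnesses d) ok) _ (admissible-bindκ (params c) c∈L adm))))

  idEnv : ∀ Γ → Env (ιs Γ) Γ
  idEnv []      ()
  idEnv (x ∷ Γ) = bind (tt ∷ []) (idEnv Γ) (var vz)

  idEnv-admissible : ∀ Γ → Admissible (idEnv Γ)
  idEnv-admissible []      ()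
  idEnv-admissible (x ∷ Γ) = admissible-bindι (tt ∷ []) (idEnv-admissible Γ)

  trF-idEnv : ∀ {Γ} (A : Form Γ) → trF (idEnv Γ) (embF A) ≡ A
  trF-idEnv {Γ} A = trans (trF-embF (idEnv Γ) A) (trans (subF-cong (idEnv-embV Γ) A) (subF-id A))
    where
    idEnv-embV : ∀ Γ {s} (v : Var Γ s) → idEnv Γ (embV v) ≡ var v
    idEnv-embV (x ∷ Γ) vz     = refl
    idEnv-embV (x ∷ Γ) (vs v) = cong (subT (toSub vs)) (idEnv-embV Γ v)

open Classes using (natClass; eqClass; witnesses)
open DerivationLemmas sigN HA-N-Ax using (cast)

proposition12 : ∀ {Γ : List ⊤} (A : LN.Form Γ) →
    HA-Class.Provable (embF A) → HA-N.Provable A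
proposition12 {Γ} A d =
  cast (trF-idEnv A)
    (translate d (All.tabulate (λ m → there (there m))) (idEnv Γ) (idEnv-admissible Γ))
  where open Translation (eqClass ∷ natClass ∷ witnesses d) (there (here refl)) (here refl)
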